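{- Let $h:[u]\to\mathcal R$ be a simple tabulation hash function, let $x_0,\dots,x_{m-1}$ be distinct keys from $[u]$, and let $Y_0,\dots,Y_{m-1}$ be random variables with $Y_i\in[0,1]$ a function of $h(x_i)$ and $\mathbb E[Y_i]=p$ for all $i$. Let $Z_i=Y_i-p$ and let $k\ge1$ be a constant integer. For $r=(r_0,\dots,r_{2k-1})\in[m]^{2k}$ let $V(r)=\mathbb E[Z_{r_0}\cdots Z_{r_{2k-1}}]$. Then the number of $2k$-tuples $r\in[m]^{2k}$ with $V(r)\ne0$ is $O(m^k)$, where the constant depends on $k$ and $c$.
   Context: Simple tabulation: fix a constant integer $c\ge1$ and an alphabet $\Sigma$ whose size is a power of two. A key $x\in[u]$ is viewed as a vector $(x_0,\dots,x_{c-1})$ of $c$ characters in $\Sigma$. A simple tabulation function $h:[u]\to\mathcal R$, $\mathcal R=[2^r]$ bit strings, is given by $c$ independent fully random tables $T_i:\Sigma\to\mathcal R$ with $h(x)=T_0[x_0]\oplus\cdots\oplus T_{c-1}[x_{c-1}]$ (bitwise XOR).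
   Formalization: The random variables $Y_i$ and the mean $p$ take rational values. -}

module Defs where

open import Data.Bool using (Bool; true; false; _xor_)
open import Data.Nat using (ℕ; zero; suc; _^_)
import Data.Nat as N
open import Data.Fin using (Fin)
open import Data.Vec using (Vec; []; _∷_; zipWith; replicate; lookup; foldr)
open import Data.List using (List; length; filter; allFin)
import Data.List as L
open import Data.Rational using (ℚ; ½; 0ℚ; 1ℚ; _+_; _*_; _-_; _≟_)
open import Relation.Nullary using (¬?)

Char : ℕ → Set
Char s = Fin (2 ^ s)

-- Keys of [u], u = |Σ|^c, viewed as vectors of c characters.
Key : ℕ → ℕ → Set
Key s c = Vec (Char s) c

-- Hash values: r-bit strings, ℛ = [2^r].
HashVal : ℕ → Set
HashVal r = Vec Bool r

_⊕_ : ∀ {r} → HashVal r → HashVal r → HashVal r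
_⊕_ = zipWith _xor_

Table : ℕ → ℕ → Set
Table s r = Vec (HashVal r) (2 ^ s)

Tables : ℕ → ℕ → ℕ → Set
Tables s r c = Vec (Table s r) c

hash : ∀ s {r c} → Tables s r c → Key s c → HashVal r
hash s [] [] = replicate _ false
hash s (T ∷ Ts) (a ∷ as) = lookup T a ⊕ hash s Ts as

-- Expectations under the uniform distribution (fully random tables).
𝔼Bool : (Bool → ℚ) → ℚ
𝔼Bool f = ½ * (f true + f false)

𝔼Vec : ∀ {A : Set} (n : ℕ) → ((A → ℚ) → ℚ) → (Vec A n → ℚ) → ℚ
𝔼Vec zero    E f = f []
𝔼Vec (suc n) E f = E (λ a → 𝔼Vec n E (λ v → f (a ∷ v)))

𝔼Hash : ∀ r → (HashVal r → ℚ) → ℚ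
𝔼Hash r = 𝔼Vec r 𝔼Bool

𝔼Table : ∀ s r → (Table s r → ℚ) → ℚ
𝔼Table s r = 𝔼Vec (2 ^ s) (𝔼Hash r)

𝔼 : ∀ s r c → (Tables s r c → ℚ) → ℚ
𝔼 s r c = 𝔼Vec c (𝔼Table s r)

allVec : ∀ {A : Set} (n : ℕ) → List A → List (Vec A n)
allVec zero    xs = L.[ [] ]
allVec (suc n) xs = L.concatMap (λ a → L.map (a ∷_) (allVec n xs)) xs

prodℚ : ∀ {n} → Vec ℚ n → ℚ
prodℚ = foldr _ _*_ 1ℚ

V : ∀ s r c {m} (k : ℕ) → (x : Fin m → Key s c) → (Y : Fin m → HashVal r → ℚ) → (p : ℚ)
  → Vec (Fin m) (2 N.* k) → ℚ
V s r c k x Y p ρ =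
  𝔼 s r c (λ T → prodℚ (Data.Vec.map (λ i → Y i (hash s T (x i)) - p) ρ))

nonzeroCount : ∀ s r c {m} (k : ℕ) → (x : Fin m → Key s c) → (Y : Fin m → HashVal r → ℚ) → (p : ℚ) → ℕ
nonzeroCount s r c {m} k x Y p =
  length (filter (λ ρ → ¬? (V s r c k x Y p ρ ≟ 0ℚ)) (allVec (2 N.* k) (allFin m)))

{-# OPTIONS --safe #-}
-- If at some position i the character of the j-th key of a tuple ρ occurs nowhere else in ρ, then
-- resampling that table entry XORs a uniform value into h(x_{ρ_j}) and leaves the other hashes alone,
-- so the centred factor Z_{ρ_j} splits off with mean 0 and V(ρ) = 0. Hence V(ρ) ≠ 0 forces every
-- position character of ρ to occur at least twice, and ρ is then constant on the classes of two
-- distinct representatives R_i, Q_i chosen per class and position. For fixed choices, the weighted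
-- number N of such ρ satisfies N² ≤ ∏_j Σ_{e,e′} w_j(e) w_j(e′) [x_e = x_e′] by induction on the
-- positions: Cauchy–Schwarz puts the weight of each class on its R-representative on one side and on
-- its Q-representative on the other. With unit weights and distinct keys the right side is m^{2k},
-- so each of the (2k)^{4kc} choices contributes at most m^k.
module Submission where

open import Defs
open import Data.Fin using (Fin; zero; suc; punchIn)
open import Data.Fin.Properties using (punchInᵢ≢i; punchOut-punchIn)
open import Data.Vec using (Vec; []; _∷_; lookup; map; removeAt; _[_]%=_; _[_]≔_)
open import Data.Vec.Properties using (lookup∘update; lookup∘update′; zipWith-comm; removeAt-punchOut)
open import Function using (_∘_)
open import Relation.Binary.PropositionalEquality

-- Expectations over random tables

_[_][_]≔_ : ∀ {A : Set} {c n} → Vec (Vec A n) c → Fin c → Fin n → A → Vec (Vec A n) c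
T [ i ][ a ]≔ v = T [ i ]%= (_[ a ]≔ v)

module _ where
  open import Data.Bool using (Bool; true; false; _xor_)
  open import Data.Bool.Properties using (xor-comm)
  open import Data.Nat using (ℕ; zero; suc)
  open import Data.Rational using (ℚ; ½; 0ℚ; 1ℚ; _+_; _*_; _-_; -_)
  open import Data.Rational.Properties using (*-identityʳ; *-comm; *-zeroʳ; +-comm; +-inverseʳ)
  open import Data.Rational.Solver using (module +-*-Solver)
  open ≡-Reasoning

  record IsExpectation {A : Set} (E : (A → ℚ) → ℚ) : Set where
    field
      𝔼-cong : ∀ {f g} → (∀ a → f a ≡ g a) → E f ≡ E g
      𝔼-+    : ∀ f g → E (λ a → f a + g a) ≡ E f + E g
      𝔼-*    : ∀ k f → E (λ a → k * f a) ≡ k * E f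
      𝔼-1    : E (λ _ → 1ℚ) ≡ 1ℚ

    𝔼-const : ∀ k → E (λ _ → k) ≡ k
    𝔼-const k = begin
      E (λ _ → k)       ≡⟨ 𝔼-cong (λ _ → sym (*-identityʳ k)) ⟩
      E (λ _ → k * 1ℚ)  ≡⟨ 𝔼-* k (λ _ → 1ℚ) ⟩
      k * E (λ _ → 1ℚ)  ≡⟨ cong (k *_) 𝔼-1 ⟩
      k * 1ℚ            ≡⟨ *-identityʳ k ⟩
      k                 ∎

    𝔼-centre : ∀ f k → E (λ a → f a - k) ≡ E f - k
    𝔼-centre f k = trans (𝔼-+ f (λ _ → - k)) (cong (E f +_) (𝔼-const (- k)))

  open IsExpectation

  Fubini : {A : Set} → ((A → ℚ) → ℚ) → Set₁
  Fubini {A} E = ∀ {B : Set} {E′ : (B → ℚ) → ℚ} → IsExpectation E′ →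
    ∀ (g : A → B → ℚ) → E (λ a → E′ (g a)) ≡ E′ (λ b → E (λ a → g a b))

  𝔼Bool-isExpectation : IsExpectation 𝔼Bool
  𝔼Bool-isExpectation = record
    { 𝔼-cong = λ f≗g → cong₂ (λ a b → ½ * (a + b)) (f≗g true) (f≗g false)
    ; 𝔼-+    = λ f g → solve 5 (λ h a b c d → h :* ((a :+ b) :+ (c :+ d)) := h :* (a :+ c) :+ h :* (b :+ d))
                                refl ½ (f true) (g true) (f false) (g false)
    ; 𝔼-*    = λ k f → solve 4 (λ h k a b → h :* (k :* a :+ k :* b) := k :* (h :* (a :+ b)))
                                refl ½ k (f true) (f false)
    ; 𝔼-1    = refl
    }
    where open +-*-Solver

  𝔼Bool-fubini : Fubini 𝔼Bool
  𝔼Bool-fubini E′ g = sym (trans (𝔼-* E′ ½ _) (cong (½ *_) (𝔼-+ E′ (g true) (g false))))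

  module _ {A : Set} {E : (A → ℚ) → ℚ} where

    𝔼Vec-isExpectation : ∀ n → IsExpectation E → IsExpectation (𝔼Vec n E)
    𝔼Vec-isExpectation zero    _ = record
      { 𝔼-cong = λ f≗g → f≗g [] ; 𝔼-+ = λ _ _ → refl ; 𝔼-* = λ _ _ → refl ; 𝔼-1 = refl }
    𝔼Vec-isExpectation (suc n) E-exp = record
      { 𝔼-cong = λ f≗g → 𝔼-cong E-exp (λ a → 𝔼-cong IH (λ v → f≗g (a ∷ v)))
      ; 𝔼-+    = λ f g → trans (𝔼-cong E-exp (λ a → 𝔼-+ IH (f ∘ (a ∷_)) (g ∘ (a ∷_)))) (𝔼-+ E-exp _ _)
      ; 𝔼-*    = λ k f → trans (𝔼-cong E-exp (λ a → 𝔼-* IH k (f ∘ (a ∷_)))) (𝔼-* E-exp k _)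
      ; 𝔼-1    = trans (𝔼-cong E-exp (λ _ → 𝔼-1 IH)) (𝔼-1 E-exp)
      }
      where IH = 𝔼Vec-isExpectation n E-exp

    𝔼Vec-fubini : ∀ n → IsExpectation E → Fubini E → Fubini (𝔼Vec n E)
    𝔼Vec-fubini zero    _     _      _  _ = refl
    𝔼Vec-fubini (suc n) E-exp E-fubini E′ g =
      trans (𝔼-cong E-exp (λ a → 𝔼Vec-fubini n E-exp E-fubini E′ (g ∘ (a ∷_))))
            (E-fubini E′ (λ a b → 𝔼Vec n E (λ v → g (a ∷ v) b)))

  𝔼Hash-isExpectation : ∀ r → IsExpectation (𝔼Hash r)
  𝔼Hash-isExpectation r = 𝔼Vec-isExpectation r 𝔼Bool-isExpectation

  𝔼Hash-fubini : ∀ r → Fubini (𝔼Hash r)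
  𝔼Hash-fubini r = 𝔼Vec-fubini r 𝔼Bool-isExpectation 𝔼Bool-fubini

  𝔼Table-isExpectation : ∀ s r → IsExpectation (𝔼Table s r)
  𝔼Table-isExpectation s r = 𝔼Vec-isExpectation _ (𝔼Hash-isExpectation r)

  𝔼-isExpectation : ∀ s r c → IsExpectation (𝔼 s r c)
  𝔼-isExpectation s r c = 𝔼Vec-isExpectation c (𝔼Table-isExpectation s r)

  Resamples : {A B : Set} → ((A → ℚ) → ℚ) → ((B → ℚ) → ℚ) → (A → B → A) → Set
  Resamples E E′ set = ∀ F → E F ≡ E (λ a → E′ (λ b → F (set a b)))

  resamples-whole : {B : Set} {E : (B → ℚ) → ℚ} → IsExpectation E → Resamples E E (λ _ b → b)
  resamples-whole E-exp F = sym (𝔼-const E-exp _)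

  resamples-coordinate : {A B : Set} {E : (A → ℚ) → ℚ} {E′ : (B → ℚ) → ℚ} {set : A → B → A} →
    ∀ n → IsExpectation E → Fubini E′ → Resamples E E′ set → (i : Fin n) →
    Resamples (𝔼Vec n E) E′ (λ v b → v [ i ]%= λ a → set a b)
  resamples-coordinate {E = E} {set = set} (suc n) E-exp E′-fubini E-resamples zero F =
    trans (E-resamples (λ a → 𝔼Vec n E (λ v → F (a ∷ v))))
          (𝔼-cong E-exp (λ a → E′-fubini (𝔼Vec-isExpectation n E-exp) (λ b v → F (set a b ∷ v))))
  resamples-coordinate {E′ = E′} {set} (suc n) E-exp E′-fubini E-resamples (suc i) F =
    𝔼-cong E-exp (λ a → resamples-coordinate {E′ = E′} {set = set} n E-exp E′-fubini E-resamples i (λ v → F (a ∷ v)))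

  𝔼-resample : ∀ s r c (i : Fin c) (a : Char s) F →
    𝔼 s r c F ≡ 𝔼 s r c (λ T → 𝔼Hash r (λ v → F (T [ i ][ a ]≔ v)))
  𝔼-resample s r c i a =
    resamples-coordinate {E′ = 𝔼Hash r} c (𝔼Table-isExpectation s r) (𝔼Hash-fubini r)
      (resamples-coordinate {E′ = 𝔼Hash r} {set = λ _ v → v} _ (𝔼Hash-isExpectation r) (𝔼Hash-fubini r)
        (resamples-whole (𝔼Hash-isExpectation r)) a) i

  MeasurePreserving : ∀ r → (HashVal r → HashVal r) → Set
  MeasurePreserving r φ = ∀ g → 𝔼Hash r (λ v → g (φ v)) ≡ 𝔼Hash r g

  ⊕-comm : ∀ {r} (u v : HashVal r) → u ⊕ v ≡ v ⊕ u
  ⊕-comm = zipWith-comm xor-comm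

  𝔼Bool-xor-invariant : ∀ w (g : Bool → ℚ) → 𝔼Bool (λ b → g (w xor b)) ≡ 𝔼Bool g
  𝔼Bool-xor-invariant false g = refl
  𝔼Bool-xor-invariant true  g = cong (½ *_) (+-comm (g false) (g true))

  ⊕ˡ-measurePreserving : ∀ {r} (w : HashVal r) → MeasurePreserving r (w ⊕_)
  ⊕ˡ-measurePreserving []       g = refl
  ⊕ˡ-measurePreserving {suc r} (w ∷ ws) g =
    trans (𝔼-cong 𝔼Bool-isExpectation (λ b → ⊕ˡ-measurePreserving ws (λ u → g ((w xor b) ∷ u))))
          (𝔼Bool-xor-invariant w (λ b → 𝔼Hash r (λ u → g (b ∷ u))))

  hash-update-elsewhere : ∀ s {r c} (i : Fin c) (a : Char s) (v : HashVal r) (T : Tables s r c) x →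
    lookup x i ≢ a → hash s (T [ i ][ a ]≔ v) x ≡ hash s T x
  hash-update-elsewhere s zero    a v (tbl ∷ Ts) (x₀ ∷ xs) x₀≢a =
    cong (_⊕ hash s Ts xs) (lookup∘update′ x₀≢a tbl v)
  hash-update-elsewhere s (suc i) a v (tbl ∷ Ts) (x₀ ∷ xs) xᵢ≢a =
    cong (lookup tbl x₀ ⊕_) (hash-update-elsewhere s i a v Ts xs xᵢ≢a)

  hash-update-measurePreserving : ∀ s {r c} (i : Fin c) (a : Char s) (T : Tables s r c) x →
    lookup x i ≡ a → MeasurePreserving r (λ v → hash s (T [ i ][ a ]≔ v) x)
  hash-update-measurePreserving s {r} zero a (tbl ∷ Ts) (x₀ ∷ xs) refl g = begin
    𝔼Hash r (λ v → g (lookup (tbl [ x₀ ]≔ v) x₀ ⊕ rest))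
      ≡⟨ 𝔼-cong H (λ v → cong (λ u → g (u ⊕ rest)) (lookup∘update x₀ tbl v)) ⟩
    𝔼Hash r (λ v → g (v ⊕ rest))
      ≡⟨ 𝔼-cong H (λ v → cong g (⊕-comm v rest)) ⟩
    𝔼Hash r (λ v → g (rest ⊕ v))
      ≡⟨ ⊕ˡ-measurePreserving rest g ⟩
    𝔼Hash r g
      ∎
    where
    rest = hash s Ts xs
    H = 𝔼Hash-isExpectation r
  hash-update-measurePreserving s (suc i) a (tbl ∷ Ts) (x₀ ∷ xs) xᵢ≡a g =
    trans (hash-update-measurePreserving s i a Ts xs xᵢ≡a (λ u → g (lookup tbl x₀ ⊕ u)))
          (⊕ˡ-measurePreserving (lookup tbl x₀) g)

  hash-uniform : ∀ s r c (i : Fin c) (x : Key s c) (G : HashVal r → ℚ) →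
    𝔼 s r c (λ T → G (hash s T x)) ≡ 𝔼Hash r G
  hash-uniform s r c i x G = begin
    𝔼 s r c (λ T → G (hash s T x))
      ≡⟨ 𝔼-resample s r c i (lookup x i) _ ⟩
    𝔼 s r c (λ T → 𝔼Hash r (λ v → G (hash s (T [ i ][ lookup x i ]≔ v) x)))
      ≡⟨ 𝔼-cong (𝔼-isExpectation s r c) (λ T → hash-update-measurePreserving s i _ T x refl G) ⟩
    𝔼 s r c (λ _ → 𝔼Hash r G)
      ≡⟨ 𝔼-const (𝔼-isExpectation s r c) _ ⟩
    𝔼Hash r G
      ∎

  -- Vanishing of moments with a unique character

  lookup-removeAt : ∀ {A : Set} {n} (xs : Vec A (suc n)) i j → lookup (removeAt xs i) j ≡ lookup xs (punchIn i j)
  lookup-removeAt xs i j = trans (cong (lookup (removeAt xs i)) (sym (punchOut-punchIn i))) (removeAt-punchOut xs _)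

  prodℚ-removeAt : ∀ {A : Set} {n} (f : A → ℚ) (xs : Vec A (suc n)) i →
    prodℚ (map f xs) ≡ f (lookup xs i) * prodℚ (map f (removeAt xs i))
  prodℚ-removeAt f (x ∷ xs)           zero    = refl
  prodℚ-removeAt f (x ∷ xs@(_ ∷ _)) (suc i) = begin
    f x * prodℚ (map f xs)                                 ≡⟨ cong (f x *_) (prodℚ-removeAt f xs i) ⟩
    f x * (f (lookup xs i) * prodℚ (map f (removeAt xs i))) ≡⟨ solve 3 (λ a b c → a :* (b :* c) := b :* (a :* c))
                                                                   refl (f x) (f (lookup xs i)) _ ⟩
    f (lookup xs i) * (f x * prodℚ (map f (removeAt xs i))) ∎
    where open +-*-Solver

  module _ (s r c : ℕ) {m : ℕ} (x : Fin m → Key s c) (Y : Fin m → HashVal r → ℚ) (p : ℚ) where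

    Z : Tables s r c → Fin m → ℚ
    Z T e = Y e (hash s T (x e)) - p

    ΠZ : ∀ {n} → Tables s r c → Vec (Fin m) n → ℚ
    ΠZ T ρ = prodℚ (map (Z T) ρ)

    UniqueCharacter : ∀ {n} → Vec (Fin m) n → Fin n → Fin c → Set
    UniqueCharacter ρ j i = ∀ l → l ≢ j → lookup (x (lookup ρ l)) i ≢ lookup (x (lookup ρ j)) i

    ΠZ-update-elsewhere : ∀ {n} i a v T (σ : Vec (Fin m) n) → (∀ l → lookup (x (lookup σ l)) i ≢ a) →
      ΠZ (T [ i ][ a ]≔ v) σ ≡ ΠZ T σ
    ΠZ-update-elsewhere i a v T []      _     = refl
    ΠZ-update-elsewhere i a v T (e ∷ σ) avoid =
      cong₂ _*_ (cong (λ u → Y e u - p) (hash-update-elsewhere s i a v T (x e) (avoid zero)))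
                (ΠZ-update-elsewhere i a v T σ (avoid ∘ suc))

    Z-centred : ∀ e i T → 𝔼Hash r (Y e) ≡ p → 𝔼Hash r (λ v → Z (T [ i ][ lookup (x e) i ]≔ v) e) ≡ 0ℚ
    Z-centred e i T 𝔼Yₑ≡p = begin
      𝔼Hash r (λ v → Y e (φ v) - p) ≡⟨ 𝔼-centre (𝔼Hash-isExpectation r) (λ v → Y e (φ v)) p ⟩
      𝔼Hash r (λ v → Y e (φ v)) - p ≡⟨ cong (_- p) (hash-update-measurePreserving s i _ T (x e) refl (Y e)) ⟩
      𝔼Hash r (Y e) - p             ≡⟨ cong (_- p) 𝔼Yₑ≡p ⟩
      p - p                         ≡⟨ +-inverseʳ p ⟩
      0ℚ                            ∎
      where φ = λ v → hash s (T [ i ][ lookup (x e) i ]≔ v) (x e)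

    𝔼ΠZ-vanishes : ∀ {n} (ρ : Vec (Fin m) n) j i → UniqueCharacter ρ j i → 𝔼Hash r (Y (lookup ρ j)) ≡ p →
      𝔼 s r c (λ T → ΠZ T ρ) ≡ 0ℚ
    𝔼ΠZ-vanishes {suc n} ρ j i unique 𝔼Yₑ≡p = begin
      𝔼 s r c (λ T → ΠZ T ρ)                                ≡⟨ 𝔼-resample s r c i a _ ⟩
      𝔼 s r c (λ T → 𝔼Hash r (λ v → ΠZ (T [ i ][ a ]≔ v) ρ)) ≡⟨ 𝔼-cong (𝔼-isExpectation s r c) inner ⟩
      𝔼 s r c (λ _ → 0ℚ)                                    ≡⟨ 𝔼-const (𝔼-isExpectation s r c) 0ℚ ⟩
      0ℚ                                                    ∎
      where
      e = lookup ρ j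
      a = lookup (x e) i

      others-avoid : ∀ l → lookup (x (lookup (removeAt ρ j) l)) i ≢ a
      others-avoid l rewrite lookup-removeAt ρ j l = unique (punchIn j l) (punchInᵢ≢i j l)

      inner : ∀ T → 𝔼Hash r (λ v → ΠZ (T [ i ][ a ]≔ v) ρ) ≡ 0ℚ
      inner T = begin
        𝔼Hash r (λ v → ΠZ (T [ i ][ a ]≔ v) ρ)     ≡⟨ 𝔼-cong (𝔼Hash-isExpectation r) factor ⟩
        𝔼Hash r (λ v → R * Z (T [ i ][ a ]≔ v) e) ≡⟨ 𝔼-* (𝔼Hash-isExpectation r) R _ ⟩
        R * 𝔼Hash r (λ v → Z (T [ i ][ a ]≔ v) e) ≡⟨ cong (R *_) (Z-centred e i T 𝔼Yₑ≡p) ⟩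
        R * 0ℚ                                    ≡⟨ *-zeroʳ R ⟩
        0ℚ                                        ∎
        where
        R = ΠZ T (removeAt ρ j)
        factor : ∀ v → ΠZ (T [ i ][ a ]≔ v) ρ ≡ R * Z (T [ i ][ a ]≔ v) e
        factor v = begin
          ΠZ (T [ i ][ a ]≔ v) ρ                                   ≡⟨ prodℚ-removeAt _ ρ j ⟩
          Z (T [ i ][ a ]≔ v) e * ΠZ (T [ i ][ a ]≔ v) (removeAt ρ j) ≡⟨ cong (Z (T [ i ][ a ]≔ v) e *_)
                                                                     (ΠZ-update-elsewhere i a v T (removeAt ρ j) others-avoid) ⟩
          Z (T [ i ][ a ]≔ v) e * R                               ≡⟨ *-comm _ R ⟩
          R * Z (T [ i ][ a ]≔ v) e                               ∎

-- Finite sums and products of naturals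

open import Data.Empty using (⊥; ⊥-elim; ⊥-elim-irr)
open import Data.Fin using (fromℕ<)
open import Data.Fin.Properties using (_≟_; any?; all?; ¬∀⟶∃¬)
open import Data.List using (List; length; filter; _++_; allFin)
import Data.List as List
open import Data.Nat using (ℕ; zero; suc; _+_; _*_; _^_; _≤_; z≤n)
open import Data.Nat.Properties hiding (_≟_)
open import Data.Nat.Solver using (module +-*-Solver)
open import Algebra.Properties.CommutativeSemigroup +-commutativeSemigroup using () renaming (interchange to +-interchange)
open import Algebra.Properties.CommutativeSemigroup *-commutativeSemigroup using () renaming (interchange to *-interchange)
open import Data.Product using (∃; ∃-syntax; _×_; _,_; proj₁; proj₂)
open import Data.Rational using (ℚ; 0ℚ; 1ℚ)
import Data.Rational as Q
open import Data.Sum using (_⊎_; inj₁; inj₂; [_,_]′)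
open import Data.Vec using (tabulate; head; tail)
open import Data.Vec.Properties using (lookup∘tabulate; tabulate∘lookup; tabulate-cong; lookup-map; map-cong)
open import Data.Vec.Relation.Unary.All using (All; []; _∷_)
import Data.Vec.Relation.Unary.All as All
open import Function.Definitions using (Injective)
open import Relation.Nullary using (¬_; Dec; yes; no; ¬?)
open import Relation.Nullary.Decidable using (map′; _×-dec_)
open import Relation.Unary using (Decidable)

record IsSum {A : Set} (S : (A → ℕ) → ℕ) : Set where
  field
    Σ-cong : ∀ {f g} → (∀ a → f a ≡ g a) → S f ≡ S g
    Σ-+    : ∀ f g → S (λ a → f a + g a) ≡ S f + S g
    Σ-*    : ∀ k f → S (λ a → k * f a) ≡ k * S f
    Σ-mono : ∀ {f g} → (∀ a → f a ≤ g a) → S f ≤ S g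
    term≤Σ : ∀ f a → f a ≤ S f

  Σ-*ʳ : ∀ f k → S (λ a → f a * k) ≡ S f * k
  Σ-*ʳ f k = trans (Σ-cong (λ a → *-comm (f a) k)) (trans (Σ-* k f) (*-comm k (S f)))

  Σ-0 : S (λ _ → 0) ≡ 0
  Σ-0 = Σ-* 0 (λ _ → 0)

  Σ-const : ∀ k → S (λ _ → k) ≡ k * S (λ _ → 1)
  Σ-const k = trans (Σ-cong (λ _ → sym (*-identityʳ k))) (Σ-* k (λ _ → 1))

open IsSum

ΣFubini : {A : Set} → ((A → ℕ) → ℕ) → Set₁
ΣFubini {A} S = ∀ {B : Set} {S′ : (B → ℕ) → ℕ} → IsSum S′ →
  ∀ (g : A → B → ℕ) → S (λ a → S′ (g a)) ≡ S′ (λ b → S (λ a → g a b))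

ΣFin : ∀ n → (Fin n → ℕ) → ℕ
ΣFin zero    f = 0
ΣFin (suc n) f = f zero + ΣFin n (f ∘ suc)

ΣVec : {A : Set} → ∀ t → ((A → ℕ) → ℕ) → (Vec A t → ℕ) → ℕ
ΣVec zero    S f = f []
ΣVec (suc t) S f = S (λ a → ΣVec t S (λ v → f (a ∷ v)))

ΣTuple : ∀ t n → (Vec (Fin n) t → ℕ) → ℕ
ΣTuple t n = ΣVec t (ΣFin n)

ΣFin-isSum : ∀ n → IsSum (ΣFin n)
ΣFin-isSum zero = record
  { Σ-cong = λ _ → refl ; Σ-+ = λ _ _ → refl ; Σ-* = λ k _ → sym (*-zeroʳ k)
  ; Σ-mono = λ _ → z≤n ; term≤Σ = λ _ () }
ΣFin-isSum (suc n) = record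
  { Σ-cong = λ f≗g → cong₂ _+_ (f≗g zero) (Σ-cong IH (f≗g ∘ suc))
  ; Σ-+    = λ f g → trans (cong (f zero + g zero +_) (Σ-+ IH (f ∘ suc) (g ∘ suc)))
                           (+-interchange (f zero) (g zero) _ _)
  ; Σ-*    = λ k f → trans (cong (k * f zero +_) (Σ-* IH k (f ∘ suc))) (sym (*-distribˡ-+ k (f zero) _))
  ; Σ-mono = λ f≤g → +-mono-≤ (f≤g zero) (Σ-mono IH (f≤g ∘ suc))
  ; term≤Σ = λ { f zero    → m≤m+n (f zero) _
               ; f (suc i) → ≤-trans (term≤Σ IH (f ∘ suc) i) (m≤n+m _ (f zero)) }
  }
  where IH = ΣFin-isSum n

ΣFin-fubini : ∀ n → ΣFubini (ΣFin n)
ΣFin-fubini zero    S′-sum g = sym (Σ-0 S′-sum)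
ΣFin-fubini (suc n) {S′ = S′} S′-sum g =
  trans (cong (S′ (g zero) +_) (ΣFin-fubini n S′-sum (g ∘ suc))) (sym (Σ-+ S′-sum (g zero) _))

module _ {A : Set} {S : (A → ℕ) → ℕ} where

  ΣVec-isSum : ∀ t → IsSum S → IsSum (ΣVec t S)
  ΣVec-isSum zero    _ = record
    { Σ-cong = λ f≗g → f≗g [] ; Σ-+ = λ _ _ → refl ; Σ-* = λ _ _ → refl
    ; Σ-mono = λ f≤g → f≤g [] ; term≤Σ = λ { f [] → ≤-refl } }
  ΣVec-isSum (suc t) S-sum = record
    { Σ-cong = λ f≗g → Σ-cong S-sum (λ a → Σ-cong IH (λ v → f≗g (a ∷ v)))
    ; Σ-+    = λ f g → trans (Σ-cong S-sum (λ a → Σ-+ IH (f ∘ (a ∷_)) (g ∘ (a ∷_)))) (Σ-+ S-sum _ _)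
    ; Σ-*    = λ k f → trans (Σ-cong S-sum (λ a → Σ-* IH k (f ∘ (a ∷_)))) (Σ-* S-sum k _)
    ; Σ-mono = λ f≤g → Σ-mono S-sum (λ a → Σ-mono IH (λ v → f≤g (a ∷ v)))
    ; term≤Σ = λ { f (a ∷ v) → ≤-trans (term≤Σ IH (f ∘ (a ∷_)) v)
                                       (term≤Σ S-sum (λ b → ΣVec t S (f ∘ (b ∷_))) a) }
    }
    where IH = ΣVec-isSum t S-sum

  ΣVec-fubini : ∀ t → IsSum S → ΣFubini S → ΣFubini (ΣVec t S)
  ΣVec-fubini zero    _     _       _  _ = refl
  ΣVec-fubini (suc t) S-sum S-fubini S′-sum g =
    trans (Σ-cong S-sum (λ a → ΣVec-fubini t S-sum S-fubini S′-sum (g ∘ (a ∷_))))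
          (S-fubini S′-sum (λ a b → ΣVec t S (λ v → g (a ∷ v) b)))

ΣTuple-isSum : ∀ t n → IsSum (ΣTuple t n)
ΣTuple-isSum t n = ΣVec-isSum t (ΣFin-isSum n)

ΣTuple-fubini : ∀ t n → ΣFubini (ΣTuple t n)
ΣTuple-fubini t n = ΣVec-fubini t (ΣFin-isSum n) (ΣFin-fubini n)

ΣPair : {A B : Set} → ((A → ℕ) → ℕ) → ((B → ℕ) → ℕ) → (A × B → ℕ) → ℕ
ΣPair S S′ f = S (λ a → S′ (λ b → f (a , b)))

ΣPair-isSum : {A B : Set} {S : (A → ℕ) → ℕ} {S′ : (B → ℕ) → ℕ} → IsSum S → IsSum S′ → IsSum (ΣPair S S′)
ΣPair-isSum S-sum S′-sum = record
  { Σ-cong = λ f≗g → Σ-cong S-sum (λ a → Σ-cong S′-sum (λ b → f≗g (a , b)))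
  ; Σ-+    = λ f g → trans (Σ-cong S-sum (λ a → Σ-+ S′-sum _ _)) (Σ-+ S-sum _ _)
  ; Σ-*    = λ k f → trans (Σ-cong S-sum (λ a → Σ-* S′-sum k _)) (Σ-* S-sum k _)
  ; Σ-mono = λ f≤g → Σ-mono S-sum (λ a → Σ-mono S′-sum (λ b → f≤g (a , b)))
  ; term≤Σ = λ { f (a , b) → ≤-trans (term≤Σ S′-sum (λ b′ → f (a , b′)) b) (term≤Σ S-sum _ a) }
  }

ΠFin : ∀ n → (Fin n → ℕ) → ℕ
ΠFin zero    f = 1
ΠFin (suc n) f = f zero * ΠFin n (f ∘ suc)

ΠFin-cong : ∀ n {f g : Fin n → ℕ} → (∀ i → f i ≡ g i) → ΠFin n f ≡ ΠFin n g
ΠFin-cong zero    _   = refl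
ΠFin-cong (suc n) f≗g = cong₂ _*_ (f≗g zero) (ΠFin-cong n (f≗g ∘ suc))

ΠFin-* : ∀ n (f g : Fin n → ℕ) → ΠFin n (λ i → f i * g i) ≡ ΠFin n f * ΠFin n g
ΠFin-* zero    f g = refl
ΠFin-* (suc n) f g = trans (cong (f zero * g zero *_) (ΠFin-* n (f ∘ suc) (g ∘ suc)))
                           (*-interchange (f zero) (g zero) _ _)

ΠFin-mono : ∀ n {f g : Fin n → ℕ} → (∀ i → f i ≤ g i) → ΠFin n f ≤ ΠFin n g
ΠFin-mono zero    _   = ≤-refl
ΠFin-mono (suc n) f≤g = *-mono-≤ (f≤g zero) (ΠFin-mono n (f≤g ∘ suc))

ΠFin-const : ∀ n k → ΠFin n (λ _ → k) ≡ k ^ n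
ΠFin-const zero    k = refl
ΠFin-const (suc n) k = cong (k *_) (ΠFin-const n k)

ΠFin-ones : ∀ n {f : Fin n → ℕ} → (∀ i → f i ≡ 1) → ΠFin n f ≡ 1
ΠFin-ones n {f} f≗1 = trans (ΠFin-cong n f≗1) (trans (ΠFin-const n 1) (^-zeroˡ n))

ΠFin≡1 : ∀ n (f : Fin n → ℕ) → ΠFin n f ≡ 1 → ∀ i → f i ≡ 1
ΠFin≡1 (suc n) f Π≡1 zero    = m*n≡1⇒m≡1 (f zero) _ Π≡1
ΠFin≡1 (suc n) f Π≡1 (suc i) = ΠFin≡1 n (f ∘ suc) (m*n≡1⇒n≡1 (f zero) _ Π≡1) i

Bit : ℕ → Set
Bit n = n ≡ 0 ⊎ n ≡ 1

bit-* : ∀ {a b} → Bit a → Bit b → Bit (a * b)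
bit-* (inj₁ refl) _           = inj₁ refl
bit-* (inj₂ refl) (inj₁ refl) = inj₁ refl
bit-* (inj₂ refl) (inj₂ refl) = inj₂ refl

ΠFin-bit : ∀ n (f : Fin n → ℕ) → (∀ i → Bit (f i)) → Bit (ΠFin n f)
ΠFin-bit zero    f _    = inj₂ refl
ΠFin-bit (suc n) f bits = bit-* (bits zero) (ΠFin-bit n (f ∘ suc) (bits ∘ suc))

bit-ext : ∀ {a b} → Bit a → Bit b → (a ≡ 1 → b ≡ 1) → (b ≡ 1 → a ≡ 1) → a ≡ b
bit-ext (inj₁ refl) (inj₁ refl) _ _ = refl
bit-ext (inj₁ refl) (inj₂ refl) _ b⇒a with () ← b⇒a refl
bit-ext (inj₂ refl) (inj₁ refl) a⇒b _ with () ← a⇒b refl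
bit-ext (inj₂ refl) (inj₂ refl) _ _ = refl

δ : ∀ {n} → Fin n → Fin n → ℕ
δ zero    zero    = 1
δ zero    (suc b) = 0
δ (suc a) zero    = 0
δ (suc a) (suc b) = δ a b

δ-bit : ∀ {n} (a b : Fin n) → Bit (δ a b)
δ-bit zero    zero    = inj₂ refl
δ-bit zero    (suc b) = inj₁ refl
δ-bit (suc a) zero    = inj₁ refl
δ-bit (suc a) (suc b) = δ-bit a b

δ-refl : ∀ {n} {a b : Fin n} → a ≡ b → δ a b ≡ 1
δ-refl {a = zero}  refl = refl
δ-refl {a = suc a} refl = δ-refl {a = a} refl

δ≡1⇒≡ : ∀ {n} (a b : Fin n) → δ a b ≡ 1 → a ≡ b
δ≡1⇒≡ zero    zero    _   = refl
δ≡1⇒≡ (suc a) (suc b) δ≡1 = cong suc (δ≡1⇒≡ a b δ≡1)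

δ-sym : ∀ {n} (a b : Fin n) → δ a b ≡ δ b a
δ-sym zero    zero    = refl
δ-sym zero    (suc b) = refl
δ-sym (suc a) zero    = refl
δ-sym (suc a) (suc b) = δ-sym a b

ΣFin-δ : ∀ n (c : Fin n) (g : Fin n → ℕ) → ΣFin n (λ a → δ a c * g a) ≡ g c
ΣFin-δ (suc n) zero    g = begin
  g zero + 0 + ΣFin n (λ _ → 0) ≡⟨ cong (g zero + 0 +_) (Σ-0 (ΣFin-isSum n)) ⟩
  g zero + 0 + 0                ≡⟨ +-identityʳ _ ⟩
  g zero + 0                    ≡⟨ +-identityʳ _ ⟩
  g zero                        ∎
  where open ≡-Reasoning
ΣFin-δ (suc n) (suc c) g = ΣFin-δ n c (g ∘ suc)

ΣFin-δˡ : ∀ n (c : Fin n) (g : Fin n → ℕ) → ΣFin n (λ a → δ c a * g a) ≡ g c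
ΣFin-δˡ n c g = trans (Σ-cong (ΣFin-isSum n) (λ a → cong (_* g a) (δ-sym c a))) (ΣFin-δ n c g)

δVec : ∀ {n t} → Vec (Fin n) t → Vec (Fin n) t → ℕ
δVec []      []      = 1
δVec (a ∷ u) (b ∷ v) = δ a b * δVec u v

δVec-lookup : ∀ {n t} (u v : Vec (Fin n) t) → δVec u v ≡ ΠFin t (λ j → δ (lookup u j) (lookup v j))
δVec-lookup []      []      = refl
δVec-lookup (a ∷ u) (b ∷ v) = cong (δ a b *_) (δVec-lookup u v)

δVec-bit : ∀ {n t} (u v : Vec (Fin n) t) → Bit (δVec u v)
δVec-bit []      []      = inj₂ refl
δVec-bit (a ∷ u) (b ∷ v) = bit-* (δ-bit a b) (δVec-bit u v)

δVec-refl : ∀ {n t} {u v : Vec (Fin n) t} → u ≡ v → δVec u v ≡ 1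
δVec-refl {u = []}    refl = refl
δVec-refl {u = a ∷ u} refl = cong₂ _*_ (δ-refl {a = a} refl) (δVec-refl {u = u} refl)

δVec≡1⇒≡ : ∀ {n t} (u v : Vec (Fin n) t) → δVec u v ≡ 1 → u ≡ v
δVec≡1⇒≡ []      []      _   = refl
δVec≡1⇒≡ (a ∷ u) (b ∷ v) δ≡1 =
  cong₂ _∷_ (δ≡1⇒≡ a b (m*n≡1⇒m≡1 _ _ δ≡1)) (δVec≡1⇒≡ u v (m*n≡1⇒n≡1 (δ a b) _ δ≡1))

δVec-sym : ∀ {n t} (u v : Vec (Fin n) t) → δVec u v ≡ δVec v u
δVec-sym []      []      = refl
δVec-sym (a ∷ u) (b ∷ v) = cong₂ _*_ (δ-sym a b) (δVec-sym u v)

ΣTuple-δ : ∀ t n (c : Vec (Fin n) t) (g : Vec (Fin n) t → ℕ) → ΣTuple t n (λ u → δVec u c * g u) ≡ g c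
ΣTuple-δ zero    n []       g = +-identityʳ (g [])
ΣTuple-δ (suc t) n (c ∷ cs) g = begin
  ΣFin n (λ a → ΣTuple t n (λ u → δ a c * δVec u cs * g (a ∷ u)))
    ≡⟨ Σ-cong (ΣFin-isSum n) (λ a → trans (Σ-cong T (λ u → *-assoc (δ a c) _ _)) (Σ-* T (δ a c) _)) ⟩
  ΣFin n (λ a → δ a c * ΣTuple t n (λ u → δVec u cs * g (a ∷ u)))
    ≡⟨ Σ-cong (ΣFin-isSum n) (λ a → cong (δ a c *_) (ΣTuple-δ t n cs (g ∘ (a ∷_)))) ⟩
  ΣFin n (λ a → δ a c * g (a ∷ cs))
    ≡⟨ ΣFin-δ n c (λ a → g (a ∷ cs)) ⟩
  g (c ∷ cs)
    ∎
  where
  open ≡-Reasoning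
  T = ΣTuple-isSum t n

ΣTuple-δˡ : ∀ t n (c : Vec (Fin n) t) (g : Vec (Fin n) t → ℕ) → ΣTuple t n (λ u → δVec c u * g u) ≡ g c
ΣTuple-δˡ t n c g = trans (Σ-cong (ΣTuple-isSum t n) (λ u → cong (_* g u) (δVec-sym c u))) (ΣTuple-δ t n c g)

ΣTuple-ΠFin : ∀ t n (g : Fin t → Fin n → ℕ) →
  ΣTuple t n (λ v → ΠFin t (λ j → g j (lookup v j))) ≡ ΠFin t (λ j → ΣFin n (g j))
ΣTuple-ΠFin zero    n g = refl
ΣTuple-ΠFin (suc t) n g =
  trans (Σ-cong (ΣFin-isSum n) (λ a → trans (Σ-* (ΣTuple-isSum t n) (g zero a) _)
                                            (cong (g zero a *_) (ΣTuple-ΠFin t n (g ∘ suc)))))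
        (Σ-*ʳ (ΣFin-isSum n) (g zero) _)

-- Cauchy–Schwarz

4mn≤[m+n]² : ∀ m n → 4 * (m * n) ≤ (m + n) * (m + n)
4mn≤[m+n]² m n = [ ordered , (λ n≤m → subst₂ _≤_ (cong (4 *_) (*-comm n m)) (cong (λ s → s * s) (+-comm n m))
                                                   (ordered n≤m)) ]′ (≤-total m n)
  where
  open +-*-Solver
  ordered : ∀ {a b} → a ≤ b → 4 * (a * b) ≤ (a + b) * (a + b)
  ordered {a} a≤b with d , refl ← m≤n⇒∃[o]m+o≡n a≤b =
    subst (4 * (a * (a + d)) ≤_)
          (solve 2 (λ a d → con 4 :* (a :* (a :+ d)) :+ d :* d := (a :+ (a :+ d)) :* (a :+ (a :+ d))) refl a d)
          (m≤m+n _ (d * d))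

m*m≤n*o⇒2m≤n+o : ∀ m n o → m * m ≤ n * o → 2 * m ≤ n + o
m*m≤n*o⇒2m≤n+o m n o m²≤no = ≮⇒≥ (λ n+o<2m → <⇒≱ (*-mono-< n+o<2m n+o<2m) squares)
  where
  open ≤-Reasoning
  open +-*-Solver
  squares : (2 * m) * (2 * m) ≤ (n + o) * (n + o)
  squares = begin
    (2 * m) * (2 * m)  ≡⟨ solve 1 (λ m → (con 2 :* m) :* (con 2 :* m) := con 4 :* (m :* m)) refl m ⟩
    4 * (m * m)        ≤⟨ *-monoʳ-≤ 4 m²≤no ⟩
    4 * (n * o)        ≤⟨ 4mn≤[m+n]² n o ⟩
    (n + o) * (n + o)  ∎

m*m≤n*n⇒m≤n : ∀ m n → m * m ≤ n * n → m ≤ n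
m*m≤n*n⇒m≤n m n m²≤n² = ≮⇒≥ (λ n<m → <⇒≱ (*-mono-< n<m n<m) m²≤n²)

cauchy-schwarz : {A : Set} {S : (A → ℕ) → ℕ} → IsSum S → (M P Q : A → ℕ) →
  (∀ a → M a * M a ≤ P a * Q a) → S M * S M ≤ S P * S Q
cauchy-schwarz {S = S} S-sum M P Q M²≤PQ = *-cancelˡ-≤ 2 (begin
  2 * (S M * S M)                                    ≡⟨ cong (2 *_) (sym (Σ-*ʳ S-sum M (S M))) ⟩
  2 * S (λ a → M a * S M)                            ≡⟨ cong (2 *_) (Σ-cong S-sum (λ a → sym (Σ-* S-sum (M a) M))) ⟩
  2 * S (λ a → S (λ b → M a * M b))                  ≡⟨ sym (Σ-* S-sum 2 _) ⟩
  S (λ a → 2 * S (λ b → M a * M b))                  ≡⟨ Σ-cong S-sum (λ a → sym (Σ-* S-sum 2 _)) ⟩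
  S (λ a → S (λ b → 2 * (M a * M b)))                ≤⟨ Σ-mono S-sum (λ a → Σ-mono S-sum (λ b →
                                                          m*m≤n*o⇒2m≤n+o (M a * M b) (P a * Q b) (P b * Q a) (cross a b))) ⟩
  S (λ a → S (λ b → P a * Q b + P b * Q a))          ≡⟨ Σ-cong S-sum (λ a → Σ-+ S-sum _ _) ⟩
  S (λ a → S (λ b → P a * Q b) + S (λ b → P b * Q a)) ≡⟨ Σ-+ S-sum _ _ ⟩
  S (λ a → S (λ b → P a * Q b)) + S (λ a → S (λ b → P b * Q a))
    ≡⟨ cong₂ _+_ (trans (Σ-cong S-sum (λ a → Σ-* S-sum (P a) Q)) (Σ-*ʳ S-sum P (S Q)))
                 (trans (Σ-cong S-sum (λ a → Σ-*ʳ S-sum P (Q a))) (Σ-* S-sum (S P) Q)) ⟩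
  S P * S Q + S P * S Q                              ≡⟨ cong (S P * S Q +_) (sym (+-identityʳ _)) ⟩
  2 * (S P * S Q)                                    ∎)
  where
  open ≤-Reasoning
  open +-*-Solver
  cross : ∀ a b → (M a * M b) * (M a * M b) ≤ (P a * Q b) * (P b * Q a)
  cross a b = begin
    (M a * M b) * (M a * M b)  ≡⟨ *-interchange (M a) (M b) (M a) (M b) ⟩
    (M a * M a) * (M b * M b)  ≤⟨ *-mono-≤ (M²≤PQ a) (M²≤PQ b) ⟩
    (P a * Q a) * (P b * Q b)  ≡⟨ solve 4 (λ pa qa pb qb → (pa :* qa) :* (pb :* qb) := (pa :* qb) :* (pb :* qa))
                                        refl (P a) (Q a) (P b) (Q b) ⟩
    (P a * Q b) * (P b * Q a)  ∎

-- Vectors constant on the classes of an idempotent map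

lookup-ext : ∀ {A : Set} {n} {xs ys : Vec A n} → (∀ i → lookup xs i ≡ lookup ys i) → xs ≡ ys
lookup-ext {xs = xs} {ys} xs≗ys =
  trans (sym (tabulate∘lookup xs)) (trans (tabulate-cong xs≗ys) (tabulate∘lookup ys))

select : {P A : Set} → Dec P → A → A → A
select (yes _) x y = x
select (no _)  x y = y

select-yes : {P A : Set} (d : Dec P) (x y : A) → P → select d x y ≡ x
select-yes (yes _) x y _ = refl
select-yes (no ¬p) x y p = ⊥-elim (¬p p)

select-no : {P A : Set} (d : Dec P) (x y : A) → ¬ P → select d x y ≡ y
select-no (yes p) x y ¬p = ⊥-elim (¬p p)
select-no (no _)  x y _  = refl

select-bit : {P : Set} (d : Dec P) {x : ℕ} → Bit x → Bit (select d 1 x)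
select-bit (yes _) _   = inj₂ refl
select-bit (no _)  bit = bit

module _ {t : ℕ} where

  Idempotent : Vec (Fin t) t → Set
  Idempotent R = ∀ j → lookup R (lookup R j) ≡ lookup R j

  isFixed? : (R : Vec (Fin t) t) (j : Fin t) → Dec (lookup R j ≡ j)
  isFixed? R j = lookup R j ≟ j

  ΠFixed : Vec (Fin t) t → (Fin t → ℕ) → ℕ
  ΠFixed R g = ΠFin t (λ j → select (isFixed? R j) (g j) 1)

  constantOn : ∀ {q} → Vec (Fin t) t → Vec (Fin q) t → ℕ
  constantOn R b = ΠFin t (λ j → δ (lookup b j) (lookup b (lookup R j)))

  module _ {q : ℕ} (R : Vec (Fin t) t) (b : Vec (Fin q) t) where

    constantOn-bit : Bit (constantOn R b)
    constantOn-bit = ΠFin-bit t _ (λ j → δ-bit (lookup b j) (lookup b (lookup R j)))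

    constantOn≡1⇒ : constantOn R b ≡ 1 → ∀ j → lookup b j ≡ lookup b (lookup R j)
    constantOn≡1⇒ const≡1 j = δ≡1⇒≡ _ _ (ΠFin≡1 t _ const≡1 j)

    constantOn≡1⇐ : (∀ j → lookup b j ≡ lookup b (lookup R j)) → constantOn R b ≡ 1
    constantOn≡1⇐ const = ΠFin-ones t (λ j → δ-refl (const j))

module _ {q t : ℕ} (z : Fin q) (R : Vec (Fin t) t) (R-idem : Idempotent R) where

  padded : Vec (Fin q) t → Vec (Fin q) t
  padded b = tabulate (λ j → select (isFixed? R j) (lookup b j) z)

  spread : Vec (Fin q) t → Vec (Fin q) t
  spread a = tabulate (λ j → lookup a (lookup R j))

  isPadded : Vec (Fin q) t → ℕ
  isPadded a = ΠFin t (λ j → select (isFixed? R j) 1 (δ (lookup a j) z))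

  isPadded-bit : ∀ a → Bit (isPadded a)
  isPadded-bit a = ΠFin-bit t _ (λ j → select-bit (isFixed? R j) (δ-bit (lookup a j) z))

  isPadded≡1⇒ : ∀ a → isPadded a ≡ 1 → ∀ j → lookup R j ≢ j → lookup a j ≡ z
  isPadded≡1⇒ a padded≡1 j unfixed =
    δ≡1⇒≡ _ _ (trans (sym (select-no (isFixed? R j) 1 _ unfixed)) (ΠFin≡1 t _ padded≡1 j))

  isPadded≡1⇐ : ∀ a → (∀ j → lookup R j ≢ j → lookup a j ≡ z) → isPadded a ≡ 1
  isPadded≡1⇐ a zeros = ΠFin-ones t (λ j → atPosition j (isFixed? R j))
    where
    atPosition : ∀ j (d : Dec (lookup R j ≡ j)) → select d 1 (δ (lookup a j) z) ≡ 1
    atPosition j (yes _)       = refl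
    atPosition j (no unfixed)  = δ-refl (zeros j unfixed)

  -- Vectors constant on the classes of R correspond to their restrictions to the fixed points of R
  -- padded with z; spread is the inverse of padded on both sides of this correspondence.
  padded-spread : ∀ a b → δVec a (padded b) * constantOn R b ≡ isPadded a * δVec b (spread a)
  padded-spread a b = bit-ext (bit-* (δVec-bit a (padded b)) (constantOn-bit R b))
                              (bit-* (isPadded-bit a) (δVec-bit b (spread a))) to from
    where
    to : δVec a (padded b) * constantOn R b ≡ 1 → isPadded a * δVec b (spread a) ≡ 1
    to eq = cong₂ _*_ (isPadded≡1⇐ a (λ j unfixed → trans (aⱼ j) (select-no (isFixed? R j) _ z unfixed)))
                      (δVec-refl {u = b} {spread a} (lookup-ext bⱼ))
      where
      a≡padded = δVec≡1⇒≡ a (padded b) (m*n≡1⇒m≡1 _ _ eq)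
      const = constantOn≡1⇒ R b (m*n≡1⇒n≡1 (δVec a (padded b)) _ eq)
      aⱼ : ∀ j → lookup a j ≡ select (isFixed? R j) (lookup b j) z
      aⱼ j = trans (cong (λ v → lookup v j) a≡padded) (lookup∘tabulate _ j)
      bⱼ : ∀ j → lookup b j ≡ lookup (spread a) j
      bⱼ j = begin
        lookup b j                                                    ≡⟨ const j ⟩
        lookup b (lookup R j)                                         ≡⟨ sym (select-yes (isFixed? R _) _ z (R-idem j)) ⟩
        select (isFixed? R (lookup R j)) (lookup b (lookup R j)) z    ≡⟨ sym (aⱼ (lookup R j)) ⟩
        lookup a (lookup R j)                                         ≡⟨ sym (lookup∘tabulate _ j) ⟩
        lookup (spread a) j                                           ∎
        where open ≡-Reasoning
    from : isPadded a * δVec b (spread a) ≡ 1 → δVec a (padded b) * constantOn R b ≡ 1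
    from eq = cong₂ _*_ (δVec-refl {u = a} {padded b}
                           (lookup-ext (λ j → trans (aⱼ j (isFixed? R j)) (sym (lookup∘tabulate _ j)))))
                        (constantOn≡1⇐ R b (λ j → trans (bⱼ j) (trans (cong (lookup a) (sym (R-idem j)))
                                                                     (sym (bⱼ (lookup R j))))))
      where
      b≡spread = δVec≡1⇒≡ b (spread a) (m*n≡1⇒n≡1 (isPadded a) _ eq)
      bⱼ : ∀ j → lookup b j ≡ lookup a (lookup R j)
      bⱼ j = trans (cong (λ v → lookup v j) b≡spread) (lookup∘tabulate _ j)
      aⱼ : ∀ j (d : Dec (lookup R j ≡ j)) → lookup a j ≡ select d (lookup b j) z
      aⱼ j (yes fixed)  = trans (cong (lookup a) (sym fixed)) (sym (bⱼ j))
      aⱼ j (no unfixed) = isPadded≡1⇒ a (m*n≡1⇒m≡1 _ _ eq) j unfixed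

  Σ-constantOn : ∀ (φ : Fin t → Fin q → ℕ) →
    ΣTuple t q (λ b → constantOn R b * ΠFixed R (λ j → φ j (lookup b j))) ≡ ΠFixed R (λ j → ΣFin q (φ j))
  Σ-constantOn φ = begin
    ΣTuple t q (λ b → constantOn R b * F b)
      ≡⟨ Σ-cong T (λ b → sym (ΣTuple-δ t q (padded b) (λ _ → constantOn R b * F b))) ⟩
    ΣTuple t q (λ b → ΣTuple t q (λ a → δVec a (padded b) * (constantOn R b * F b)))
      ≡⟨ ΣTuple-fubini t q T _ ⟩
    ΣTuple t q (λ a → ΣTuple t q (λ b → δVec a (padded b) * (constantOn R b * F b)))
      ≡⟨ Σ-cong T (λ a → Σ-cong T (λ b → change-variables a b)) ⟩
    ΣTuple t q (λ a → ΣTuple t q (λ b → isPadded a * (δVec b (spread a) * F b)))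
      ≡⟨ Σ-cong T (λ a → trans (Σ-* T (isPadded a) _) (cong (isPadded a *_) (ΣTuple-δ t q (spread a) F))) ⟩
    ΣTuple t q (λ a → isPadded a * F (spread a))
      ≡⟨ Σ-cong T (λ a → trans (sym (ΠFin-* t _ _)) (ΠFin-cong t (λ j → merge a j (isFixed? R j)))) ⟩
    ΣTuple t q (λ a → ΠFin t (λ j → select (isFixed? R j) (φ j (lookup a j)) (δ (lookup a j) z)))
      ≡⟨ ΣTuple-ΠFin t q _ ⟩
    ΠFin t (λ j → ΣFin q (λ c → select (isFixed? R j) (φ j c) (δ c z)))
      ≡⟨ ΠFin-cong t (λ j → ΣFin-select j (isFixed? R j)) ⟩
    ΠFixed R (λ j → ΣFin q (φ j))
      ∎
    where
    open ≡-Reasoning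
    T = ΣTuple-isSum t q
    F : Vec (Fin q) t → ℕ
    F b = ΠFixed R (λ j → φ j (lookup b j))

    change-variables : ∀ a b → δVec a (padded b) * (constantOn R b * F b) ≡ isPadded a * (δVec b (spread a) * F b)
    change-variables a b = begin
      δVec a (padded b) * (constantOn R b * F b)  ≡⟨ sym (*-assoc (δVec a (padded b)) _ _) ⟩
      δVec a (padded b) * constantOn R b * F b    ≡⟨ cong (_* F b) (padded-spread a b) ⟩
      isPadded a * δVec b (spread a) * F b        ≡⟨ *-assoc (isPadded a) _ _ ⟩
      isPadded a * (δVec b (spread a) * F b)      ∎

    merge : ∀ a j (d : Dec (lookup R j ≡ j)) →
      select d 1 (δ (lookup a j) z) * select d (φ j (lookup (spread a) j)) 1 ≡ select d (φ j (lookup a j)) (δ (lookup a j) z)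
    merge a j (yes fixed) = trans (+-identityʳ _) (cong (φ j) (trans (lookup∘tabulate _ j) (cong (lookup a) fixed)))
    merge a j (no _)      = *-identityʳ _

    ΣFin-select : ∀ j (d : Dec (lookup R j ≡ j)) → ΣFin q (λ c → select d (φ j c) (δ c z)) ≡ select d (ΣFin q (φ j)) 1
    ΣFin-select j (yes _) = refl
    ΣFin-select j (no _)  = trans (Σ-cong (ΣFin-isSum q) (λ c → sym (*-identityʳ (δ c z)))) (ΣFin-δ q z (λ _ → 1))

-- R and Q pick two distinct representatives in every class of one partition of the positions.
record DistinctRepresentatives {t : ℕ} (R Q : Vec (Fin t) t) : Set where
  field
    R-idem : Idempotent R
    Q-idem : Idempotent Q
    R∘Q≡R  : ∀ j → lookup R (lookup Q j) ≡ lookup R j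
    Q∘R≡Q  : ∀ j → lookup Q (lookup R j) ≡ lookup Q j
    R≢Q    : ∀ j → lookup R j ≢ lookup Q j

constantOn-R≡Q : ∀ {q t} {R Q : Vec (Fin t) t} → DistinctRepresentatives R Q →
  ∀ (b : Vec (Fin q) t) → constantOn R b ≡ constantOn Q b
constantOn-R≡Q {R = R} {Q} RQ b = bit-ext (constantOn-bit R b) (constantOn-bit Q b)
  (λ constR → let c = constantOn≡1⇒ R b constR in
    constantOn≡1⇐ Q b (λ j → trans (c j) (trans (cong (lookup b) (sym (R∘Q≡R j))) (sym (c (lookup Q j))))))
  (λ constQ → let c = constantOn≡1⇒ Q b constQ in
    constantOn≡1⇐ R b (λ j → trans (c j) (trans (cong (lookup b) (sym (Q∘R≡Q j))) (sym (c (lookup R j))))))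
  where open DistinctRepresentatives RQ

module _ {q t : ℕ} (z : Fin q) {R Q : Vec (Fin t) t} (RQ : DistinctRepresentatives R Q) where
  open DistinctRepresentatives RQ

  -- Cauchy–Schwarz: A keeps the factors f j at the R-representatives, B those at the Q-representatives
  -- and the full sums G j at all other positions.
  Σ-constantOn-bound : (f : Fin t → Fin q → ℕ) (M : Vec (Fin q) t → ℕ) →
    (∀ b → M b * M b ≤ ΠFin t (λ j → f j (lookup b j))) →
    ΣTuple t q (λ b → constantOn R b * M b) * ΣTuple t q (λ b → constantOn R b * M b) ≤ ΠFin t (λ j → ΣFin q (f j))
  Σ-constantOn-bound f M M²≤Πf = begin
    ΣTuple t q (λ b → constantOn R b * M b) * ΣTuple t q (λ b → constantOn R b * M b)
      ≤⟨ cauchy-schwarz T _ (λ b → constantOn R b * A b) (λ b → constantOn R b * B b) M²≤AB ⟩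
    ΣTuple t q (λ b → constantOn R b * A b) * ΣTuple t q (λ b → constantOn R b * B b)
      ≡⟨ cong₂ _*_ (Σ-constantOn z R R-idem f) ΣB ⟩
    ΠFixed R G * (K * ΠFixed Q G)
      ≡⟨ sym (ΠFin-*³ G G) ⟩
    ΠFin t (λ j → onR j (G j) * (elsewhere j * onQ j (G j)))
      ≡⟨ ΠFin-cong t (λ j → G-split j (isFixed? R j) (isFixed? Q j)) ⟩
    ΠFin t G
      ∎
    where
    open ≤-Reasoning
    open +-*-Solver
    T = ΣTuple-isSum t q
    G : Fin t → ℕ
    G j = ΣFin q (f j)
    A : Vec (Fin q) t → ℕ
    A b = ΠFixed R (λ j → f j (lookup b j))
    onR onQ : Fin t → ℕ → ℕ
    onR j n = select (isFixed? R j) n 1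
    onQ j n = select (isFixed? Q j) n 1
    elsewhere : Fin t → ℕ
    elsewhere j = select (isFixed? Q j) 1 (select (isFixed? R j) 1 (G j))
    K : ℕ
    K = ΠFin t elsewhere
    B : Vec (Fin q) t → ℕ
    B b = K * ΠFixed Q (λ j → f j (lookup b j))

    ΠFin-*³ : (g h : Fin t → ℕ) → ΠFin t (λ j → onR j (g j) * (elsewhere j * onQ j (h j))) ≡ ΠFixed R g * (K * ΠFixed Q h)
    ΠFin-*³ g h = trans (ΠFin-* t _ _) (cong (ΠFixed R g *_) (ΠFin-* t _ _))

    unfixed-somewhere : ∀ j → lookup R j ≡ j → lookup Q j ≡ j → ⊥
    unfixed-somewhere j Rj≡j Qj≡j = R≢Q j (trans Rj≡j (sym Qj≡j))

    f-split : ∀ j c (dR : Dec (lookup R j ≡ j)) (dQ : Dec (lookup Q j ≡ j)) →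
      f j c ≤ select dR (f j c) 1 * (select dQ 1 (select dR 1 (G j)) * select dQ (f j c) 1)
    f-split j c (yes Rj≡j) (yes Qj≡j) = ⊥-elim (unfixed-somewhere j Rj≡j Qj≡j)
    f-split j c (yes _)    (no _)     = ≤-reflexive (sym (*-identityʳ (f j c)))
    f-split j c (no _)     (yes _)    = ≤-reflexive (sym (trans (+-identityʳ _) (+-identityʳ _)))
    f-split j c (no _)     (no _)     = ≤-trans (term≤Σ (ΣFin-isSum q) (f j) c)
                                                (≤-reflexive (sym (trans (+-identityʳ _) (*-identityʳ (G j)))))

    G-split : ∀ j (dR : Dec (lookup R j ≡ j)) (dQ : Dec (lookup Q j ≡ j)) →
      select dR (G j) 1 * (select dQ 1 (select dR 1 (G j)) * select dQ (G j) 1) ≡ G j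
    G-split j (yes Rj≡j) (yes Qj≡j) = ⊥-elim (unfixed-somewhere j Rj≡j Qj≡j)
    G-split j (yes _)    (no _)     = *-identityʳ (G j)
    G-split j (no _)     (yes _)    = trans (+-identityʳ _) (+-identityʳ _)
    G-split j (no _)     (no _)     = trans (+-identityʳ _) (*-identityʳ (G j))

    M²≤AB : ∀ b → (constantOn R b * M b) * (constantOn R b * M b) ≤ (constantOn R b * A b) * (constantOn R b * B b)
    M²≤AB b with constantOn R b | constantOn-bit R b
    ... | _ | inj₁ refl = z≤n
    ... | _ | inj₂ refl = subst₂ _≤_ (cong₂ _*_ (sym (*-identityˡ (M b))) (sym (*-identityˡ (M b))))
                                     (cong₂ _*_ (sym (*-identityˡ (A b))) (sym (*-identityˡ (B b))))
      (≤-trans (M²≤Πf b) (≤-trans (ΠFin-mono t (λ j → f-split j (lookup b j) (isFixed? R j) (isFixed? Q j)))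
                                  (≤-reflexive (ΠFin-*³ _ _))))

    ΣB : ΣTuple t q (λ b → constantOn R b * B b) ≡ K * ΠFixed Q G
    ΣB = begin-equality
      ΣTuple t q (λ b → constantOn R b * (K * ΠFixed Q (λ j → f j (lookup b j))))
        ≡⟨ Σ-cong T (λ b → trans (cong (_* B b) (constantOn-R≡Q RQ b))
                                 (solve 3 (λ c k p → c :* (k :* p) := k :* (c :* p)) refl (constantOn Q b) K _)) ⟩
      ΣTuple t q (λ b → K * (constantOn Q b * ΠFixed Q (λ j → f j (lookup b j))))
        ≡⟨ Σ-* T K _ ⟩
      K * ΣTuple t q (λ b → constantOn Q b * ΠFixed Q (λ j → f j (lookup b j)))
        ≡⟨ cong (K *_) (Σ-constantOn z Q Q-idem f) ⟩
      K * ΠFixed Q G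
        ∎

Representatives : ℕ → Set
Representatives t = Vec (Fin t) t × Vec (Fin t) t

Distinct : ∀ {t} → Representatives t → Set
Distinct (R , Q) = DistinctRepresentatives R Q

δVec-[] : ∀ {n} (u v : Vec (Fin n) 0) → δVec u v ≡ 1
δVec-[] [] [] = refl

δVec-∷ : ∀ {n k} (u v : Vec (Fin n) (suc k)) → δVec u v ≡ δ (head u) (head v) * δVec (tail u) (tail v)
δVec-∷ (a ∷ u) (b ∷ v) = refl

collisions : ∀ {q m c} → (Fin m → Vec (Fin q) c) → (Fin m → ℕ) → ℕ
collisions {m = m} x w = ΣFin m (λ e → ΣFin m (λ e′ → (w e * w e′) * δVec (x e) (x e′)))

module _ {q t m : ℕ} where

  respects : ∀ {c} → (Fin m → Vec (Fin q) c) → Vec (Representatives t) c → Vec (Fin m) t → ℕ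
  respects x []             ρ = 1
  respects x ((R , Q) ∷ σ) ρ = constantOn R (map (head ∘ x) ρ) * respects (tail ∘ x) σ ρ

  weightedCount : ∀ {c} → (Fin m → Vec (Fin q) c) → Vec (Representatives t) c → (Fin t → Fin m → ℕ) → ℕ
  weightedCount x σ w = ΣTuple t m (λ ρ → ΠFin t (λ j → w j (lookup ρ j)) * respects x σ ρ)

  weightedCount-heads : ∀ {c} (x : Fin m → Vec (Fin q) (suc c)) R Q σ w →
    weightedCount x ((R , Q) ∷ σ) w
      ≡ ΣTuple t q (λ b → constantOn R b * weightedCount (tail ∘ x) σ (λ j e → w j e * δ (head (x e)) (lookup b j)))
  weightedCount-heads x R Q σ w = begin
    ΣTuple t m (λ ρ → Πw ρ * (constantOn R (heads ρ) * C ρ))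
      ≡⟨ Σ-cong Tm expand ⟩
    ΣTuple t m (λ ρ → ΣTuple t q (λ b → constantOn R b * (Πw ρ * δVec (heads ρ) b * C ρ)))
      ≡⟨ ΣTuple-fubini t m Tq _ ⟩
    ΣTuple t q (λ b → ΣTuple t m (λ ρ → constantOn R b * (Πw ρ * δVec (heads ρ) b * C ρ)))
      ≡⟨ Σ-cong Tq (λ b → trans (Σ-* Tm (constantOn R b) _)
                                (cong (constantOn R b *_) (Σ-cong Tm (λ ρ → cong (_* C ρ) (restricted-weights ρ b))))) ⟩
    ΣTuple t q (λ b → constantOn R b * weightedCount (tail ∘ x) σ (λ j e → w j e * δ (head (x e)) (lookup b j)))
      ∎
    where
    open ≡-Reasoning
    open +-*-Solver
    Tm = ΣTuple-isSum t m
    Tq = ΣTuple-isSum t q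
    heads : Vec (Fin m) t → Vec (Fin q) t
    heads = map (head ∘ x)
    Πw : Vec (Fin m) t → ℕ
    Πw ρ = ΠFin t (λ j → w j (lookup ρ j))
    C : Vec (Fin m) t → ℕ
    C = respects (tail ∘ x) σ

    expand : ∀ ρ → Πw ρ * (constantOn R (heads ρ) * C ρ)
                     ≡ ΣTuple t q (λ b → constantOn R b * (Πw ρ * δVec (heads ρ) b * C ρ))
    expand ρ = begin
      Πw ρ * (constantOn R (heads ρ) * C ρ)
        ≡⟨ cong (λ n → Πw ρ * (n * C ρ)) (sym (ΣTuple-δˡ t q (heads ρ) (constantOn R))) ⟩
      Πw ρ * (ΣTuple t q (λ b → δVec (heads ρ) b * constantOn R b) * C ρ)
        ≡⟨ cong (Πw ρ *_) (sym (Σ-*ʳ Tq _ (C ρ))) ⟩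
      Πw ρ * ΣTuple t q (λ b → δVec (heads ρ) b * constantOn R b * C ρ)
        ≡⟨ sym (Σ-* Tq (Πw ρ) _) ⟩
      ΣTuple t q (λ b → Πw ρ * (δVec (heads ρ) b * constantOn R b * C ρ))
        ≡⟨ Σ-cong Tq (λ b → solve 4 (λ p d k c → p :* (d :* k :* c) := k :* (p :* d :* c))
                                     refl (Πw ρ) (δVec (heads ρ) b) (constantOn R b) (C ρ)) ⟩
      ΣTuple t q (λ b → constantOn R b * (Πw ρ * δVec (heads ρ) b * C ρ))
        ∎

    restricted-weights : ∀ ρ b → Πw ρ * δVec (heads ρ) b
                                  ≡ ΠFin t (λ j → w j (lookup ρ j) * δ (head (x (lookup ρ j))) (lookup b j))
    restricted-weights ρ b = trans
      (cong (Πw ρ *_) (trans (δVec-lookup (heads ρ) b)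
                             (ΠFin-cong t (λ j → cong (λ a → δ a (lookup b j)) (lookup-map j (head ∘ x) ρ)))))
      (sym (ΠFin-* t _ _))

  collisions-heads : ∀ {c} (x : Fin m → Vec (Fin q) (suc c)) v →
    ΣFin q (λ a → collisions (tail ∘ x) (λ e → v e * δ (head (x e)) a)) ≡ collisions x v
  collisions-heads x v = begin
    ΣFin q (λ a → ΣFin m (λ e → ΣFin m (λ e′ → summand a e e′)))  ≡⟨ ΣFin-fubini q (ΣFin-isSum m) _ ⟩
    ΣFin m (λ e → ΣFin q (λ a → ΣFin m (λ e′ → summand a e e′)))  ≡⟨ Σ-cong (ΣFin-isSum m) (λ e →
                                                                      ΣFin-fubini q (ΣFin-isSum m) _) ⟩
    ΣFin m (λ e → ΣFin m (λ e′ → ΣFin q (λ a → summand a e e′)))  ≡⟨ Σ-cong (ΣFin-isSum m) (λ e →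
                                                                      Σ-cong (ΣFin-isSum m) (head-collision e)) ⟩
    collisions x v                                                ∎
    where
    open ≡-Reasoning
    open +-*-Solver
    h : Fin m → Fin q
    h = head ∘ x
    D : Fin m → Fin m → ℕ
    D e e′ = δVec (tail (x e)) (tail (x e′))
    summand : Fin q → Fin m → Fin m → ℕ
    summand a e e′ = (v e * δ (h e) a) * (v e′ * δ (h e′) a) * D e e′

    head-collision : ∀ e e′ → ΣFin q (λ a → summand a e e′) ≡ (v e * v e′) * δVec (x e) (x e′)
    head-collision e e′ = begin
      ΣFin q (λ a → summand a e e′)
        ≡⟨ Σ-cong (ΣFin-isSum q) (λ a →
             solve 5 (λ u d u′ d′ n → (u :* d) :* (u′ :* d′) :* n := d :* (d′ :* (u :* u′ :* n)))
                   refl (v e) (δ (h e) a) (v e′) (δ (h e′) a) (D e e′)) ⟩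
      ΣFin q (λ a → δ (h e) a * (δ (h e′) a * (v e * v e′ * D e e′)))
        ≡⟨ ΣFin-δˡ q (h e) _ ⟩
      δ (h e′) (h e) * (v e * v e′ * D e e′)
        ≡⟨ solve 3 (λ d u n → d :* (u :* n) := u :* (d :* n)) refl (δ (h e′) (h e)) (v e * v e′) (D e e′) ⟩
      v e * v e′ * (δ (h e′) (h e) * D e e′)
        ≡⟨ cong (λ d → v e * v e′ * (d * D e e′)) (δ-sym (h e′) (h e)) ⟩
      v e * v e′ * (δ (h e) (h e′) * D e e′)
        ≡⟨ cong (v e * v e′ *_) (sym (δVec-∷ (x e) (x e′))) ⟩
      v e * v e′ * δVec (x e) (x e′)
        ∎

  weightedCount-bound : (z : Fin q) → ∀ {c} (x : Fin m → Vec (Fin q) c) σ → All Distinct σ → ∀ w →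
    weightedCount x σ w * weightedCount x σ w ≤ ΠFin t (λ j → collisions x (w j))
  weightedCount-bound z x [] [] w = ≤-reflexive (begin
    weightedCount x [] w * weightedCount x [] w         ≡⟨ cong₂ _*_ count count ⟩
    ΠFin t (λ j → ΣFin m (w j)) * ΠFin t (λ j → ΣFin m (w j)) ≡⟨ sym (ΠFin-* t _ _) ⟩
    ΠFin t (λ j → ΣFin m (w j) * ΣFin m (w j))           ≡⟨ ΠFin-cong t (λ j → sym (squares (w j))) ⟩
    ΠFin t (λ j → collisions x (w j))                    ∎)
    where
    open ≡-Reasoning
    count : weightedCount x [] w ≡ ΠFin t (λ j → ΣFin m (w j))
    count = trans (Σ-cong (ΣTuple-isSum t m) (λ ρ → *-identityʳ _)) (ΣTuple-ΠFin t m w)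
    squares : ∀ v → collisions x v ≡ ΣFin m v * ΣFin m v
    squares v = trans (Σ-cong Fm (λ e → trans (Σ-cong Fm (λ e′ → trans (cong (v e * v e′ *_) (δVec-[] (x e) (x e′)))
                                                                      (*-identityʳ _)))
                                              (Σ-* Fm (v e) v)))
                      (Σ-*ʳ Fm v _)
      where Fm = ΣFin-isSum m
  weightedCount-bound z {suc c} x ((R , Q) ∷ σ) (RQ ∷ σ-distinct) w =
    subst (λ N → N * N ≤ ΠFin t (λ j → collisions x (w j))) (sym (weightedCount-heads x R Q σ w))
      (≤-trans (Σ-constantOn-bound z RQ f M (λ b → weightedCount-bound z (tail ∘ x) σ σ-distinct (restrict b)))
               (≤-reflexive (ΠFin-cong t (λ j → collisions-heads x (w j)))))
    where
    restrict : Vec (Fin q) t → Fin t → Fin m → ℕ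
    restrict b j e = w j e * δ (head (x e)) (lookup b j)
    M : Vec (Fin q) t → ℕ
    M b = weightedCount (tail ∘ x) σ (restrict b)
    f : Fin t → Fin q → ℕ
    f j a = collisions (tail ∘ x) (λ e → w j e * δ (head (x e)) a)

-- Representatives of a tuple without unique characters

-- The witness is irrelevant, so the element picked depends only on the predicate: representatives
-- picked below depend only on the character they represent.
pick : ∀ {n} {P : Fin n → Set} → Decidable P → .(∃ P) → Fin n
pick P? ∃P with any? P?
... | yes (l , _) = l
... | no ∄P       = ⊥-elim-irr (∄P ∃P)

pick-satisfies : ∀ {n} {P : Fin n → Set} (P? : Decidable P) .(∃P : ∃ P) → P (pick P? ∃P)
pick-satisfies P? ∃P with any? P?
... | yes (_ , Pl) = Pl
... | no ∄P        = ⊥-elim-irr (∄P ∃P)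

module _ {q t : ℕ} (cs : Vec (Fin q) t) where

  Paired : Set
  Paired = ∀ j → ∃[ l ] l ≢ j × lookup cs l ≡ lookup cs j

  paired? : Dec Paired
  paired? = all? (λ j → any? (λ l → ¬? (l ≟ j) ×-dec (lookup cs l ≟ lookup cs j)))

  ¬paired⇒unique : ¬ Paired → ∃[ j ] ∀ l → l ≢ j → lookup cs l ≢ lookup cs j
  ¬paired⇒unique ¬paired with ¬∀⟶∃¬ t _ (λ j → any? (λ l → ¬? (l ≟ j) ×-dec (lookup cs l ≟ lookup cs j)))
                                       ¬paired
  ... | j , ∄l = j , λ l l≢j csₗ≡csⱼ → ∄l (l , l≢j , csₗ≡csⱼ)

  representative : (a : Fin q) → .(∃[ l ] lookup cs l ≡ a) → Fin t
  representative a = pick (λ l → lookup cs l ≟ a)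

  otherRepresentative : (a : Fin q) (r : Fin t) → .(∃[ l ] lookup cs l ≡ a × l ≢ r) → Fin t
  otherRepresentative a r = pick (λ l → (lookup cs l ≟ a) ×-dec ¬? (l ≟ r))

  representative-cong : ∀ {a a′} .{e e′} → a ≡ a′ → representative a e ≡ representative a′ e′
  representative-cong refl = refl

  otherRepresentative-cong : ∀ {a a′ r r′} .{e e′} → a ≡ a′ → r ≡ r′ →
    otherRepresentative a r e ≡ otherRepresentative a′ r′ e′
  otherRepresentative-cong refl refl = refl

  tabulate-absorbs : ∀ {F G : Fin t → Fin t} → (∀ {j j′} → lookup cs j ≡ lookup cs j′ → F j ≡ F j′) →
    (∀ j → lookup cs (G j) ≡ lookup cs j) → ∀ j → lookup (tabulate F) (lookup (tabulate G) j) ≡ lookup (tabulate F) j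
  tabulate-absorbs {F} {G} F-cong G-same j = begin
    lookup (tabulate F) (lookup (tabulate G) j) ≡⟨ lookup∘tabulate F _ ⟩
    F (lookup (tabulate G) j)                   ≡⟨ F-cong (trans (cong (lookup cs) (lookup∘tabulate G j)) (G-same j)) ⟩
    F j                                         ≡⟨ sym (lookup∘tabulate F j) ⟩
    lookup (tabulate F) j                       ∎
    where open ≡-Reasoning

  rep₁ : Fin t → Fin t
  rep₁ j = representative (lookup cs j) (j , refl)

  rep₁-same : ∀ j → lookup cs (rep₁ j) ≡ lookup cs j
  rep₁-same j = pick-satisfies (λ l → lookup cs l ≟ lookup cs j) (j , refl)

  rep₁-cong : ∀ {j j′} → lookup cs j ≡ lookup cs j′ → rep₁ j ≡ rep₁ j′
  rep₁-cong = representative-cong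

  module _ (paired : Paired) where

    second-occurrence : ∀ j → ∃[ l ] lookup cs l ≡ lookup cs j × l ≢ rep₁ j
    second-occurrence j with paired j
    ... | l , l≢j , csₗ≡csⱼ with l ≟ rep₁ j
    ...   | no  l≢rep = l , csₗ≡csⱼ , l≢rep
    ...   | yes l≡rep = j , refl , λ j≡rep → l≢j (trans l≡rep (sym j≡rep))

    rep₂ : Fin t → Fin t
    rep₂ j = otherRepresentative (lookup cs j) (rep₁ j) (second-occurrence j)

    rep₂-spec : ∀ j → lookup cs (rep₂ j) ≡ lookup cs j × rep₂ j ≢ rep₁ j
    rep₂-spec j = pick-satisfies (λ l → (lookup cs l ≟ lookup cs j) ×-dec ¬? (l ≟ rep₁ j)) (second-occurrence j)

    rep₂-same : ∀ j → lookup cs (rep₂ j) ≡ lookup cs j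
    rep₂-same j = proj₁ (rep₂-spec j)

    rep₁≢rep₂ : ∀ j → rep₁ j ≢ rep₂ j
    rep₁≢rep₂ j same = proj₂ (rep₂-spec j) (sym same)

    rep₂-cong : ∀ {j j′} → lookup cs j ≡ lookup cs j′ → rep₂ j ≡ rep₂ j′
    rep₂-cong csⱼ≡csⱼ′ = otherRepresentative-cong csⱼ≡csⱼ′ (rep₁-cong csⱼ≡csⱼ′)

    reps₁ reps₂ : Vec (Fin t) t
    reps₁ = tabulate rep₁
    reps₂ = tabulate rep₂

    reps-distinct : DistinctRepresentatives reps₁ reps₂
    reps-distinct = record
      { R-idem = tabulate-absorbs rep₁-cong rep₁-same
      ; Q-idem = tabulate-absorbs rep₂-cong rep₂-same
      ; R∘Q≡R  = tabulate-absorbs rep₁-cong rep₂-same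
      ; Q∘R≡Q  = tabulate-absorbs rep₂-cong rep₁-same
      ; R≢Q    = λ j same → rep₁≢rep₂ j (trans (sym (lookup∘tabulate rep₁ j)) (trans same (lookup∘tabulate rep₂ j)))
      }

    constantOn-reps₁ : constantOn reps₁ cs ≡ 1
    constantOn-reps₁ =
      constantOn≡1⇐ reps₁ cs (λ j → sym (trans (cong (lookup cs) (lookup∘tabulate rep₁ j)) (rep₁-same j)))

𝟙 : {P : Set} → Dec P → ℕ
𝟙 (yes _) = 1
𝟙 (no _)  = 0

ΣList : {A : Set} → List A → (A → ℕ) → ℕ
ΣList List.[]       f = 0
ΣList (a List.∷ as) f = f a + ΣList as f

ΣList-++ : {A : Set} (xs ys : List A) (f : A → ℕ) → ΣList (xs ++ ys) f ≡ ΣList xs f + ΣList ys f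
ΣList-++ List.[]       ys f = refl
ΣList-++ (a List.∷ as) ys f = trans (cong (f a +_) (ΣList-++ as ys f)) (sym (+-assoc (f a) _ _))

ΣList-cong : {A : Set} (xs : List A) {f g : A → ℕ} → (∀ a → f a ≡ g a) → ΣList xs f ≡ ΣList xs g
ΣList-cong List.[]       f≗g = refl
ΣList-cong (a List.∷ as) f≗g = cong₂ _+_ (f≗g a) (ΣList-cong as f≗g)

ΣList-map : {A B : Set} (g : A → B) (xs : List A) (f : B → ℕ) → ΣList (List.map g xs) f ≡ ΣList xs (f ∘ g)
ΣList-map g List.[]       f = refl
ΣList-map g (a List.∷ as) f = cong (f (g a) +_) (ΣList-map g as f)

ΣList-concatMap : {A B : Set} (F : A → List B) (xs : List A) (f : B → ℕ) →
  ΣList (List.concatMap F xs) f ≡ ΣList xs (λ a → ΣList (F a) f)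
ΣList-concatMap F List.[]       f = refl
ΣList-concatMap F (a List.∷ as) f = trans (ΣList-++ (F a) _ f) (cong (ΣList (F a) f +_) (ΣList-concatMap F as f))

length-filter : {A : Set} {P : A → Set} (P? : Decidable P) (xs : List A) →
  length (filter P? xs) ≡ ΣList xs (λ a → 𝟙 (P? a))
length-filter P? List.[]       = refl
length-filter P? (a List.∷ as) with P? a
... | yes _ = cong suc (length-filter P? as)
... | no  _ = length-filter P? as

ΣList-allVec : {A : Set} (n : ℕ) (xs : List A) (f : Vec A n → ℕ) → ΣList (allVec n xs) f ≡ ΣVec n (ΣList xs) f
ΣList-allVec zero    xs f = +-identityʳ (f [])
ΣList-allVec (suc n) xs f = begin
  ΣList (List.concatMap (λ a → List.map (a ∷_) (allVec n xs)) xs) f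
    ≡⟨ ΣList-concatMap _ xs f ⟩
  ΣList xs (λ a → ΣList (List.map (a ∷_) (allVec n xs)) f)
    ≡⟨ ΣList-cong xs (λ a → trans (ΣList-map (a ∷_) (allVec n xs) f) (ΣList-allVec n xs (f ∘ (a ∷_)))) ⟩
  ΣList xs (λ a → ΣVec n (ΣList xs) (f ∘ (a ∷_)))
    ∎
  where open ≡-Reasoning

ΣList-tabulate : {A : Set} (n : ℕ) (g : Fin n → A) (f : A → ℕ) → ΣList (List.tabulate g) f ≡ ΣFin n (f ∘ g)
ΣList-tabulate zero    g f = refl
ΣList-tabulate (suc n) g f = cong (f (g zero) +_) (ΣList-tabulate n (g ∘ suc) f)

ΣVec-cong : {A : Set} {S S′ : (A → ℕ) → ℕ} → (∀ f → S f ≡ S′ f) → IsSum S′ →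
  ∀ t f → ΣVec t S f ≡ ΣVec t S′ f
ΣVec-cong S≗S′ S′-sum zero    f = refl
ΣVec-cong S≗S′ S′-sum (suc t) f =
  trans (S≗S′ _) (Σ-cong S′-sum (λ a → ΣVec-cong S≗S′ S′-sum t (f ∘ (a ∷_))))

ΣFin-ones : ∀ n → ΣFin n (λ _ → 1) ≡ n
ΣFin-ones zero    = refl
ΣFin-ones (suc n) = cong suc (ΣFin-ones n)

ΣVec-ones : {A : Set} {S : (A → ℕ) → ℕ} → IsSum S → ∀ t → ΣVec t S (λ _ → 1) ≡ S (λ _ → 1) ^ t
ΣVec-ones S-sum zero    = refl
ΣVec-ones {S = S} S-sum (suc t) = begin
  S (λ _ → ΣVec t S (λ _ → 1))   ≡⟨ Σ-cong S-sum (λ _ → ΣVec-ones S-sum t) ⟩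
  S (λ _ → S (λ _ → 1) ^ t)      ≡⟨ Σ-const S-sum _ ⟩
  S (λ _ → 1) ^ t * S (λ _ → 1)  ≡⟨ *-comm _ (S (λ _ → 1)) ⟩
  S (λ _ → 1) ^ suc t            ∎
  where open ≡-Reasoning

distinctRepresentatives? : ∀ {t} (RQ : Representatives t) → Dec (Distinct RQ)
distinctRepresentatives? (R , Q) =
  map′ (λ (Ri , Qi , RQ , QR , R≢Q) → record { R-idem = Ri ; Q-idem = Qi ; R∘Q≡R = RQ ; Q∘R≡Q = QR ; R≢Q = R≢Q })
       (λ d → let open DistinctRepresentatives d in R-idem , Q-idem , R∘Q≡R , Q∘R≡Q , R≢Q)
       (all? (λ j → lookup R (lookup R j) ≟ lookup R j) ×-dec all? (λ j → lookup Q (lookup Q j) ≟ lookup Q j)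
          ×-dec all? (λ j → lookup R (lookup Q j) ≟ lookup R j) ×-dec all? (λ j → lookup Q (lookup R j) ≟ lookup Q j)
          ×-dec all? (λ j → ¬? (lookup R j ≟ lookup Q j)))

module _ {q t m : ℕ} where

  column : ∀ {c} → (Fin m → Vec (Fin q) c) → Fin c → Vec (Fin m) t → Vec (Fin q) t
  column x i = map (λ e → lookup (x e) i)

  column-zero : ∀ {c} (x : Fin m → Vec (Fin q) (suc c)) ρ → column x zero ρ ≡ map (head ∘ x) ρ
  column-zero x = map-cong (λ e → lookup-zero (x e))
    where lookup-zero : ∀ {c} (v : Vec (Fin q) (suc c)) → lookup v zero ≡ head v
          lookup-zero (a ∷ v) = refl

  column-suc : ∀ {c} (x : Fin m → Vec (Fin q) (suc c)) (i : Fin c) ρ → column x (suc i) ρ ≡ column (tail ∘ x) i ρ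
  column-suc {c} x i = map-cong (λ e → lookup-suc (x e))
    where lookup-suc : (v : Vec (Fin q) (suc c)) → lookup v (suc i) ≡ lookup (tail v) i
          lookup-suc (a ∷ v) = refl

  canonical : ∀ {c} (x : Fin m → Vec (Fin q) c) ρ → (∀ i → Paired (column x i ρ)) →
    ∃[ σ ] All Distinct σ × respects x σ ρ ≡ 1
  canonical {zero}  x ρ _      = [] , [] , refl
  canonical {suc c} x ρ paired with canonical (tail ∘ x) ρ (λ i → subst Paired (column-suc x i ρ) (paired (suc i)))
  ... | σ , σ-distinct , respects≡1 =
    (reps₁ heads heads-paired , reps₂ heads heads-paired) ∷ σ ,
    reps-distinct heads heads-paired ∷ σ-distinct ,
    cong₂ _*_ (constantOn-reps₁ heads heads-paired) respects≡1
    where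
    heads = map (head ∘ x) ρ
    heads-paired = subst Paired (column-zero x ρ) (paired zero)

collisions-injective : ∀ {q m c} (x : Fin m → Vec (Fin q) c) → Injective _≡_ _≡_ x → collisions x (λ _ → 1) ≡ m
collisions-injective {m = m} x x-injective = begin
  ΣFin m (λ e → ΣFin m (λ e′ → 1 * 1 * δVec (x e) (x e′))) ≡⟨ Σ-cong Fm (λ e → Σ-cong Fm (λ e′ →
                                                                trans (+-identityʳ _) (δVec≡δ e e′))) ⟩
  ΣFin m (λ e → ΣFin m (λ e′ → δ e e′))                    ≡⟨ Σ-cong Fm (λ e → trans (Σ-cong Fm (λ e′ →
                                                                sym (*-identityʳ (δ e e′)))) (ΣFin-δˡ m e (λ _ → 1))) ⟩
  ΣFin m (λ _ → 1)                                         ≡⟨ ΣFin-ones m ⟩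
  m                                                        ∎
  where
  open ≡-Reasoning
  Fm = ΣFin-isSum m
  δVec≡δ : ∀ e e′ → δVec (x e) (x e′) ≡ δ e e′
  δVec≡δ e e′ = bit-ext (δVec-bit (x e) (x e′)) (δ-bit e e′)
    (λ δVec≡1 → δ-refl (x-injective (δVec≡1⇒≡ (x e) (x e′) δVec≡1)))
    (λ δ≡1 → δVec-refl {u = x e} {x e′} (cong x (δ≡1⇒≡ e e′ δ≡1)))

module _ (s r c k : ℕ) {m : ℕ} (x : Fin m → Key s c) (x-injective : Injective _≡_ _≡_ x)
         (Y : Fin m → HashVal r → ℚ) (p : ℚ) (𝔼Y≡p : ∀ e → 𝔼 s r c (λ T → Y e (hash s T (x e))) ≡ p) where

  private
    t : ℕ
    t = 2 * k

  nonzero? : (ρ : Vec (Fin m) t) → Dec (V s r c k x Y p ρ ≢ 0ℚ)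
  nonzero? ρ = ¬? (V s r c k x Y p ρ Q.≟ 0ℚ)

  nonzero⇒paired : ∀ ρ → V s r c k x Y p ρ ≢ 0ℚ → ∀ i → Paired (column x i ρ)
  nonzero⇒paired ρ V≢0 i with paired? (column x i ρ)
  ... | yes paired = paired
  ... | no ¬paired with ¬paired⇒unique (column x i ρ) ¬paired
  ...   | j , unique = ⊥-elim (V≢0 (𝔼ΠZ-vanishes s r c x Y p ρ j i unique-in-ρ 𝔼Yⱼ≡p))
    where
    character : Fin m → Char s
    character e = lookup (x e) i
    unique-in-ρ : UniqueCharacter s r c x Y p ρ j i
    unique-in-ρ l l≢j same = unique l l≢j (trans (lookup-map l character ρ) (trans same (sym (lookup-map j character ρ))))
    𝔼Yⱼ≡p : 𝔼Hash r (Y (lookup ρ j)) ≡ p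
    𝔼Yⱼ≡p = trans (sym (hash-uniform s r c i (x (lookup ρ j)) (Y (lookup ρ j)))) (𝔼Y≡p (lookup ρ j))

  ΣRepresentatives : (Vec (Representatives t) c → ℕ) → ℕ
  ΣRepresentatives = ΣVec c (ΣPair (ΣTuple t t) (ΣTuple t t))

  ΣRepresentatives-isSum : IsSum ΣRepresentatives
  ΣRepresentatives-isSum = ΣVec-isSum c (ΣPair-isSum (ΣTuple-isSum t t) (ΣTuple-isSum t t))

  allDistinct? : (σ : Vec (Representatives t) c) → Dec (All Distinct σ)
  allDistinct? = All.all? distinctRepresentatives?

  nonzero≤respecting : ∀ ρ → 𝟙 (nonzero? ρ) ≤ ΣRepresentatives (λ σ → 𝟙 (allDistinct? σ) * respects x σ ρ)
  nonzero≤respecting ρ with nonzero? ρ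
  ... | no _    = z≤n
  ... | yes V≢0 with canonical x ρ (nonzero⇒paired ρ V≢0)
  ...   | σ , σ-distinct , respects≡1 = ≤-trans (≤-reflexive (sym term≡1)) (term≤Σ ΣRepresentatives-isSum _ σ)
    where
    term≡1 : 𝟙 (allDistinct? σ) * respects x σ ρ ≡ 1
    term≡1 with allDistinct? σ
    ... | yes _            = trans (+-identityʳ _) respects≡1
    ... | no ¬σ-distinct = ⊥-elim (¬σ-distinct σ-distinct)

  respecting≤ : ∀ σ → All Distinct σ → ΣTuple t m (respects x σ) ≤ m ^ k
  respecting≤ σ σ-distinct = m*m≤n*n⇒m≤n _ _ (begin
    ΣTuple t m (respects x σ) * ΣTuple t m (respects x σ)  ≡⟨ cong₂ _*_ unweighted unweighted ⟨
    weightedCount x σ (λ _ _ → 1) * weightedCount x σ (λ _ _ → 1)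
      ≤⟨ weightedCount-bound (fromℕ< (m^n>0 2 s)) x σ σ-distinct (λ _ _ → 1) ⟩
    ΠFin t (λ _ → collisions x (λ _ → 1))                   ≡⟨ ΠFin-cong t (λ _ → collisions-injective x x-injective) ⟩
    ΠFin t (λ _ → m)                                        ≡⟨ ΠFin-const t m ⟩
    m ^ (k + (k + 0))                                       ≡⟨ ^-distribˡ-+-* m k (k + 0) ⟩
    m ^ k * m ^ (k + 0)                                     ≡⟨ cong (λ n → m ^ k * m ^ n) (+-identityʳ k) ⟩
    m ^ k * m ^ k                                           ∎)
    where
    open ≤-Reasoning
    unweighted : weightedCount x σ (λ _ _ → 1) ≡ ΣTuple t m (respects x σ)
    unweighted = Σ-cong (ΣTuple-isSum t m) (λ ρ → trans (cong (_* respects x σ ρ) (ΠFin-ones t (λ _ → refl)))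
                                                         (+-identityʳ _))

  distinct-respecting≤ : ∀ σ → 𝟙 (allDistinct? σ) * ΣTuple t m (respects x σ) ≤ m ^ k
  distinct-respecting≤ σ with allDistinct? σ
  ... | yes σ-distinct = ≤-trans (≤-reflexive (+-identityʳ _)) (respecting≤ σ σ-distinct)
  ... | no _           = z≤n

  nonzeroCount≡ΣTuple : nonzeroCount s r c k x Y p ≡ ΣTuple t m (λ ρ → 𝟙 (nonzero? ρ))
  nonzeroCount≡ΣTuple = begin
    nonzeroCount s r c k x Y p                          ≡⟨ length-filter nonzero? (allVec t (allFin m)) ⟩
    ΣList (allVec t (allFin m)) (λ ρ → 𝟙 (nonzero? ρ))  ≡⟨ ΣList-allVec t (allFin m) _ ⟩
    ΣVec t (ΣList (allFin m)) (λ ρ → 𝟙 (nonzero? ρ))    ≡⟨ ΣVec-cong (ΣList-tabulate m (λ e → e)) (ΣFin-isSum m) t _ ⟩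
    ΣTuple t m (λ ρ → 𝟙 (nonzero? ρ))                   ∎
    where open ≡-Reasoning

  ΣRepresentatives-ones : ΣRepresentatives (λ _ → 1) ≡ (t ^ t * t ^ t) ^ c
  ΣRepresentatives-ones = trans (ΣVec-ones (ΣPair-isSum (ΣTuple-isSum t t) (ΣTuple-isSum t t)) c)
                                (cong (_^ c) (trans (Σ-const (ΣTuple-isSum t t) _) (cong₂ _*_ tuples tuples)))
    where
    tuples : ΣTuple t t (λ _ → 1) ≡ t ^ t
    tuples = trans (ΣVec-ones (ΣFin-isSum t) t) (cong (_^ t) (ΣFin-ones t))

  nonzeroCount≤ : nonzeroCount s r c k x Y p ≤ (t ^ t * t ^ t) ^ c * m ^ k
  nonzeroCount≤ = begin
    nonzeroCount s r c k x Y p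
      ≡⟨ nonzeroCount≡ΣTuple ⟩
    ΣTuple t m (λ ρ → 𝟙 (nonzero? ρ))
      ≤⟨ Σ-mono (ΣTuple-isSum t m) nonzero≤respecting ⟩
    ΣTuple t m (λ ρ → ΣRepresentatives (λ σ → 𝟙 (allDistinct? σ) * respects x σ ρ))
      ≡⟨ ΣTuple-fubini t m ΣRepresentatives-isSum _ ⟩
    ΣRepresentatives (λ σ → ΣTuple t m (λ ρ → 𝟙 (allDistinct? σ) * respects x σ ρ))
      ≡⟨ Σ-cong ΣRepresentatives-isSum (λ σ → Σ-* (ΣTuple-isSum t m) (𝟙 (allDistinct? σ)) _) ⟩
    ΣRepresentatives (λ σ → 𝟙 (allDistinct? σ) * ΣTuple t m (respects x σ))
      ≤⟨ Σ-mono ΣRepresentatives-isSum distinct-respecting≤ ⟩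
    ΣRepresentatives (λ _ → m ^ k)
      ≡⟨ trans (Σ-const ΣRepresentatives-isSum (m ^ k)) (*-comm (m ^ k) _) ⟩
    ΣRepresentatives (λ _ → 1) * m ^ k
      ≡⟨ cong (_* m ^ k) ΣRepresentatives-ones ⟩
    (t ^ t * t ^ t) ^ c * m ^ k
      ∎
    where open ≤-Reasoning

lemma15 : (c k : ℕ) → 1 ≤ c → 1 ≤ k →
    ∃[ C ] (∀ (s r m : ℕ) (x : Fin m → Key s c) → Injective _≡_ _≡_ x →
    (Y : Fin m → HashVal r → ℚ) (p : ℚ) →
    (∀ i v → (0ℚ Q.≤ Y i v) × (Y i v Q.≤ 1ℚ)) →
    (∀ i → 𝔼 s r c (λ T → Y i (hash s T (x i))) ≡ p) →
    nonzeroCount s r c k x Y p ≤ C * m ^ k)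
lemma15 c k _ _ = ((2 * k) ^ (2 * k) * (2 * k) ^ (2 * k)) ^ c ,
  λ s r m x x-injective Y p _ 𝔼Y≡p → nonzeroCount≤ s r c k x x-injective Y p 𝔼Y≡p
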